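{- Let $p$ be a prime, $n\ge4$, and let $\alpha=(\alpha_1,\dots,\alpha_{n-1})$ be the tuple $(2,1,\dots,1,2,1,\dots,1,\beta)$, i.e. $\alpha_1=2$, $\alpha_k=2$ for some position $k$ with $2\le k\le n-2$, $\alpha_{n-1}=\beta$ with $\beta>1$ an integer, and all other entries equal to $1$. Let $r=n-1-k$. Then \[g_\alpha(p)=p^{n-3+r}+p^{n-3}(p-1)r.\]
   Context: For a prime $p$ and a tuple $\alpha=(\alpha_1,\dots,\alpha_{n-1})$ of positive integers, an irreducible subring matrix with diagonal $\alpha$ is an $n\times n$ upper triangular integer matrix $A$ with $A_{ii}=p^{\alpha_i}$ for $1\le i\le n-1$, $A_{nn}=1$, $A_{in}=1$ for all $i$, and $A_{ij}=p\,a_{ij}$ with integers $0\le a_{ij}\le p^{\alpha_i-1}-1$ for $1\le i<j\le n-1$, such that the $\mathbb{Z}$-span of the columns of $A$ is closed under componentwise multiplication of vectors. $g_\alpha(p)$ denotes the number of irreducible subring matrices with diagonal $\alpha$. -}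

module Defs where

open import Data.Nat as ℕ using (ℕ; zero; suc; _∸_; _<_; _≟_)
open import Data.Integer as ℤ using (ℤ; +_)
open import Data.Fin using (Fin; toℕ; inject₁; fromℕ)
open import Data.Vec using (Vec; lookup; tabulate; map; zipWith; foldr)
open import Data.List using (List; length)
open import Data.List.Relation.Unary.Unique.Propositional using (Unique)
open import Data.List.Membership.Propositional using (_∈_)
open import Data.Product using (Σ; ∃; _×_)
open import Function.Bundles using (_⇔_)
open import Relation.Binary.PropositionalEquality using (_≡_)
open import Relation.Nullary using (yes; no)

Matrix : ℕ → Set
Matrix N = Vec (Vec ℤ N) N

entry : ∀ {N} → Matrix N → Fin N → Fin N → ℤ
entry A i j = lookup (lookup A i) j

sumℤ : ∀ {N} → Vec ℤ N → ℤ
sumℤ = foldr _ ℤ._+_ (+ 0)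

mulVec : ∀ {N} → Matrix N → Vec ℤ N → Vec ℤ N
mulVec A c = map (λ row → sumℤ (zipWith ℤ._*_ row c)) A

InColSpan : ∀ {N} → Matrix N → Vec ℤ N → Set
InColSpan {N} A v = Σ (Vec ℤ N) λ c → mulVec A c ≡ v

_⊙_ : ∀ {N} → Vec ℤ N → Vec ℤ N → Vec ℤ N
u ⊙ v = zipWith ℤ._*_ u v

SubringClosed : ∀ {N} → Matrix N → Set
SubringClosed A = ∀ u v → InColSpan A u → InColSpan A v → InColSpan A (u ⊙ v)

-- Irreducible subring matrix of size n = suc m with diagonal α = (α₁,…,α_m), α_i ≥ 1.
-- Indices are 0-based: Fin (suc m), the last index (fromℕ m) is n.
record IsIrrSubringMatrix (p m : ℕ) (α : Vec ℕ m) (A : Matrix (suc m)) : Set where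
  field
    upperTriangular : ∀ (i j : Fin (suc m)) → toℕ j < toℕ i → entry A i j ≡ + 0
    diagonal        : ∀ (i : Fin m) → entry A (inject₁ i) (inject₁ i) ≡ + (p ℕ.^ lookup α i)
    lastDiagonal    : entry A (fromℕ m) (fromℕ m) ≡ + 1
    lastColumn      : ∀ (i : Fin (suc m)) → entry A i (fromℕ m) ≡ + 1
    offDiagonal     : ∀ (i j : Fin m) → toℕ i < toℕ j →
                      ∃ λ (a : ℕ) → (a < p ℕ.^ (lookup α i ∸ 1)) ×
                                     (entry A (inject₁ i) (inject₁ j) ≡ + (p ℕ.* a))
    closed          : SubringClosed A

HasCount : ∀ {N} → (Matrix N → Set) → ℕ → Set
HasCount {N} P k =
  Σ (List (Matrix N)) λ xs → Unique xs × (∀ A → (A ∈ xs) ⇔ P A) × (length xs ≡ k)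

gCount : (p m : ℕ) → Vec ℕ m → ℕ → Set
gCount p m α k = HasCount (IsIrrSubringMatrix p m α) k

-- α = (2,1,…,1,2,1,…,1,β) of length m = n-1: α₁ = 2, α_k = 2, α_{n-1} = β, others 1.
-- (0-based position i corresponds to α_{i+1}.)
alphaEntry : (m k β : ℕ) → ℕ → ℕ
alphaEntry m k β i with i ≟ 0
... | yes _ = 2
... | no _ with i ≟ (k ∸ 1)
...   | yes _ = 2
...   | no _ with i ≟ (m ∸ 1)
...     | yes _ = β
...     | no _ = 1

alpha : (m k β : ℕ) → Vec ℕ m
alpha m k β = tabulate λ i → alphaEntry m k β (toℕ i)

module Submission where

open import Data.Nat as ℕ using (ℕ; zero; suc)
import Data.Nat.Properties as ℕP
open import Data.Nat.Primality using (Prime)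
import Data.Integer.Properties as ℤP
open import Data.Integer.Tactic.RingSolver using (solve-∀)
open import Data.Fin as F using (Fin; toℕ)
import Data.Fin.Properties as FinP
open import Data.Vec as Vec using (Vec; lookup; tabulate)
import Data.Vec.Properties as VecP
open import Data.List as List using (List; length)
import Data.List.Properties as ListP
open import Data.List.Membership.Propositional using (_∈_)
import Data.List.Membership.Propositional.Properties as ∈P
open import Data.List.Relation.Unary.Any using (here; there)
import Data.List.Relation.Unary.All as All
import Data.List.Relation.Unary.All.Properties as AllP
open import Data.List.Relation.Unary.AllPairs as AllPairs using ()
open import Data.List.Relation.Unary.Unique.Propositional using (Unique)
import Data.List.Relation.Unary.Unique.Propositional.Properties as UniqueP
open import Data.Product using (Σ; ∃; _×_; _,_; proj₁; proj₂)
open import Data.Sum using (_⊎_; inj₁; inj₂)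
open import Data.Empty using (⊥; ⊥-elim)
open import Relation.Nullary using (¬_; Dec; yes; no)
open import Relation.Binary.PropositionalEquality
open import Relation.Binary.Definitions using (tri<; tri≈; tri>)
open import Function using (_∘_)
open import Defs

-- Only rows 1 and k of such a matrix can have nonzero off-diagonal coefficients
-- (α_i = 1 forces a_ij = 0, and row n − 1 has none), so the matrix is given by two rows
-- b, c with entries in [0, p). Closure under multiplication reduces to the products of
-- pairs of columns; all of them lie in the column span automatically except for pairs of
-- "ordinary" columns i, j ∉ {1, k, n}, whose product is a combination of columns only if
-- p divides b_k · y_ij, where y_ij = c_i c_j for i ≠ j and y_ii = c_i (c_i − p^(α_i − 1)).
-- If b_k = 0 this is automatic: p^(n−3) choices of b and p^r of c. If b_k ≠ 0 then
-- p ∣ y_ij forces c to be zero or a single entry 1 at a position k < j < n − 1 (at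
-- j = n − 1 the exponent β > 1 makes c_j ≡ 0): (p − 1) p^(n−3) choices of b and r of c.

module ColumnSpan where

  open import Data.Integer using (ℤ; +_; _+_; _*_; _-_; -_)
  open import Algebra.Properties.Semiring.Sum ℤP.+-*-semiring
    using (sum; sum-cong-≗; ∑-distrib-+; ∑-comm; *-distribˡ-sum; sum-replicate-zero)
  open import Data.Vec using (zipWith)
  open import Data.List using ([]; _∷_)

  vec-ext : ∀ {a} {A : Set a} {n} {xs ys : Vec A n} → (∀ i → lookup xs i ≡ lookup ys i) → xs ≡ ys
  vec-ext {xs = xs} {ys} eq =
    trans (sym (VecP.tabulate∘lookup xs)) (trans (VecP.tabulate-cong eq) (VecP.tabulate∘lookup ys))

  sum-single : ∀ {n} (f : Fin n → ℤ) (i : Fin n) → (∀ j → j ≢ i → f j ≡ + 0) → sum f ≡ f i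
  sum-single {suc n} f F.zero f≡0 =
    trans (cong (_+_ (f F.zero)) (trans (sum-cong-≗ (λ j → f≡0 (F.suc j) λ ())) (sum-replicate-zero n)))
          (ℤP.+-identityʳ _)
  sum-single {suc n} f (F.suc i) f≡0 =
    trans (cong₂ _+_ (f≡0 F.zero λ ())
                     (sum-single (λ j → f (F.suc j)) i λ j j≢i → f≡0 (F.suc j) (j≢i ∘ FinP.suc-injective)))
          (ℤP.+-identityˡ _)

  rowDot : ∀ {n} → Matrix n → Vec ℤ n → Fin n → ℤ
  rowDot A c r = sum λ s → entry A r s * lookup c s

  sumℤ-zipWith-* : ∀ {n} (xs ys : Vec ℤ n) → sumℤ (zipWith _*_ xs ys) ≡ sum λ j → lookup xs j * lookup ys j
  sumℤ-zipWith-* Vec.[] Vec.[] = refl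
  sumℤ-zipWith-* (x Vec.∷ xs) (y Vec.∷ ys) = cong (_+_ (x * y)) (sumℤ-zipWith-* xs ys)

  lookup-mulVec : ∀ {n} (A : Matrix n) c r → lookup (mulVec A c) r ≡ rowDot A c r
  lookup-mulVec A c r = trans (VecP.lookup-map r _ A) (sumℤ-zipWith-* (lookup A r) c)

  mulVec≡⇒rowDot≡ : ∀ {n} (A : Matrix n) {c v} → mulVec A c ≡ v → ∀ r → rowDot A c r ≡ lookup v r
  mulVec≡⇒rowDot≡ A {c} Ac≡v r = trans (sym (lookup-mulVec A c r)) (cong (λ w → lookup w r) Ac≡v)

  rowDot≡⇒mulVec≡ : ∀ {n} (A : Matrix n) {c v} → (∀ r → rowDot A c r ≡ lookup v r) → mulVec A c ≡ v
  rowDot≡⇒mulVec≡ A {c} eq = vec-ext λ r → trans (lookup-mulVec A c r) (eq r)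

  rowDot-zipWith-- : ∀ {n} (A : Matrix n) e f r →
                     rowDot A (zipWith _-_ e f) r ≡ rowDot A e r - rowDot A f r
  rowDot-zipWith-- A e f r = begin
      sum (λ s → a s * lookup (zipWith _-_ e f) s)
    ≡⟨ sum-cong-≗ (λ s → trans (cong (a s *_) (VecP.lookup-zipWith _-_ s e f)) (split (a s) _ _)) ⟩
      sum (λ s → a s * lookup e s + - + 1 * (a s * lookup f s))
    ≡⟨ ∑-distrib-+ (λ s → a s * lookup e s) _ ⟩
      rowDot A e r + sum (λ s → - + 1 * (a s * lookup f s))
    ≡⟨ cong (_+_ (rowDot A e r)) (sym (*-distribˡ-sum (- + 1) λ s → a s * lookup f s)) ⟩
      rowDot A e r + - + 1 * rowDot A f r
    ≡⟨ merge (rowDot A e r) (rowDot A f r) ⟩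
      rowDot A e r - rowDot A f r ∎
    where
    open ≡-Reasoning
    a : Fin _ → ℤ
    a = entry A r
    split : ∀ x y z → x * (y - z) ≡ x * y + - + 1 * (x * z)
    split = solve-∀
    merge : ∀ x y → x + - + 1 * y ≡ x - y
    merge = solve-∀

  col : ∀ {n} → Matrix n → Fin n → Vec ℤ n
  col A i = tabulate λ r → entry A r i

  lookup-col⊙col : ∀ {n} (A : Matrix n) i j r → lookup (col A i ⊙ col A j) r ≡ entry A r i * entry A r j
  lookup-col⊙col A i j r = trans (VecP.lookup-zipWith _*_ r (col A i) (col A j))
    (cong₂ _*_ (VecP.lookup∘tabulate _ r) (VecP.lookup∘tabulate _ r))

  closed-from-column-products : ∀ {n} (A : Matrix n) →
    (∀ i j → InColSpan A (col A i ⊙ col A j)) → SubringClosed A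
  closed-from-column-products {n} A w u v (c , Ac≡u) (d , Ad≡v) = e , rowDot≡⇒mulVec≡ A row
    where
    W : Fin n → Fin n → Fin n → ℤ
    W i j = lookup (proj₁ (w i j))
    cd : Fin n → Fin n → ℤ
    cd i j = lookup c i * lookup d j
    e : Vec ℤ n
    e = tabulate λ s → sum λ i → sum λ j → cd i j * W i j s
    row : ∀ r → rowDot A e r ≡ lookup (u ⊙ v) r
    row r = begin
        sum (λ s → a s * lookup e s)
      ≡⟨ sum-cong-≗ (λ s → trans (cong (a s *_) (VecP.lookup∘tabulate _ s))
                      (trans (*-distribˡ-sum (a s) (λ i → sum λ j → cd i j * W i j s))
                             (sum-cong-≗ λ i → *-distribˡ-sum (a s) λ j → cd i j * W i j s))) ⟩
        sum (λ s → sum λ i → sum λ j → a s * (cd i j * W i j s))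
      ≡⟨ ∑-comm (λ s i → sum λ j → a s * (cd i j * W i j s)) ⟩
        sum (λ i → sum λ s → sum λ j → a s * (cd i j * W i j s))
      ≡⟨ sum-cong-≗ (λ i → ∑-comm (λ s j → a s * (cd i j * W i j s))) ⟩
        sum (λ i → sum λ j → sum λ s → a s * (cd i j * W i j s))
      ≡⟨ sum-cong-≗ (λ i → sum-cong-≗ λ j → trans (sum-cong-≗ λ s → reorder (a s) (cd i j) _)
                                                 (sym (*-distribˡ-sum (cd i j) λ s → a s * W i j s))) ⟩
        sum (λ i → sum λ j → cd i j * rowDot A (proj₁ (w i j)) r)
      ≡⟨ sum-cong-≗ (λ i → sum-cong-≗ λ j →
           trans (cong (cd i j *_) (trans (mulVec≡⇒rowDot≡ A (proj₂ (w i j)) r) (lookup-col⊙col A i j r)))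
                 (regroup (lookup c i) (lookup d j) (a i) (a j))) ⟩
        sum (λ i → sum λ j → (a i * lookup c i) * (a j * lookup d j))
      ≡⟨ sum-cong-≗ (λ i → sym (*-distribˡ-sum (a i * lookup c i) λ j → a j * lookup d j)) ⟩
        sum (λ i → (a i * lookup c i) * rowDot A d r)
      ≡⟨ trans (sum-cong-≗ λ i → ℤP.*-comm (a i * lookup c i) (rowDot A d r))
               (trans (sym (*-distribˡ-sum (rowDot A d r) λ i → a i * lookup c i)) (ℤP.*-comm (rowDot A d r) _)) ⟩
        rowDot A c r * rowDot A d r
      ≡⟨ cong₂ _*_ (mulVec≡⇒rowDot≡ A Ac≡u r) (mulVec≡⇒rowDot≡ A Ad≡v r) ⟩
        lookup u r * lookup v r
      ≡⟨ sym (VecP.lookup-zipWith _*_ r u v) ⟩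
        lookup (u ⊙ v) r ∎
      where
      open ≡-Reasoning
      a : Fin n → ℤ
      a = entry A r
      reorder : ∀ x y z → x * (y * z) ≡ y * (x * z)
      reorder = solve-∀
      regroup : ∀ x y z t → x * y * (z * t) ≡ z * x * (t * y)
      regroup = solve-∀

  Combination : ℕ → Set
  Combination n = List (ℤ × Fin n)

  combine : ∀ {n} → Matrix n → Combination n → Fin n → ℤ
  combine A [] r = + 0
  combine A ((a , t) ∷ l) r = a * entry A r t + combine A l r

  scaledBasis : ∀ {n} → Fin n → ℤ → Fin n → ℤ
  scaledBasis t a s with s F.≟ t
  ... | yes _ = a
  ... | no _ = + 0

  coefficients : ∀ {n} → Combination n → Fin n → ℤ
  coefficients [] s = + 0
  coefficients ((a , t) ∷ l) s = scaledBasis t a s + coefficients l s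

  rowDot-coefficients : ∀ {n} (A : Matrix n) l r → rowDot A (tabulate (coefficients l)) r ≡ combine A l r
  rowDot-coefficients {n} A [] r =
    trans (sum-cong-≗ λ s → trans (cong (entry A r s *_) (VecP.lookup∘tabulate _ s)) (ℤP.*-zeroʳ (entry A r s)))
          (sum-replicate-zero n)
  rowDot-coefficients A ((a , t) ∷ l) r = begin
      sum (λ s → entry A r s * lookup (tabulate (coefficients ((a , t) ∷ l))) s)
    ≡⟨ sum-cong-≗ (λ s → trans (cong (entry A r s *_) (VecP.lookup∘tabulate _ s)) (ℤP.*-distribˡ-+ (entry A r s) _ _)) ⟩
      sum (λ s → entry A r s * scaledBasis t a s + entry A r s * coefficients l s)
    ≡⟨ ∑-distrib-+ (λ s → entry A r s * scaledBasis t a s) _ ⟩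
      sum (λ s → entry A r s * scaledBasis t a s) + sum (λ s → entry A r s * coefficients l s)
    ≡⟨ cong₂ _+_ (trans (sum-single _ t off-t) (trans (cong (entry A r t *_) at-t) (ℤP.*-comm _ a)))
                 (trans (sum-cong-≗ λ s → cong (entry A r s *_) (sym (VecP.lookup∘tabulate (coefficients l) s)))
                        (rowDot-coefficients A l r)) ⟩
      a * entry A r t + combine A l r ∎
    where
    open ≡-Reasoning
    at-t : scaledBasis t a t ≡ a
    at-t with t F.≟ t
    ... | yes _ = refl
    ... | no t≢t = ⊥-elim (t≢t refl)
    off-t : ∀ s → s ≢ t → entry A r s * scaledBasis t a s ≡ + 0
    off-t s s≢t with s F.≟ t
    ... | yes s≡t = ⊥-elim (s≢t s≡t)
    ... | no _ = ℤP.*-zeroʳ (entry A r s)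

  combination∈span : ∀ {n} (A : Matrix n) (l : Combination n) {v} →
                     (∀ r → lookup v r ≡ combine A l r) → InColSpan A v
  combination∈span A l eq =
    tabulate (coefficients l) , rowDot≡⇒mulVec≡ A λ r → trans (rowDot-coefficients A l r) (sym (eq r))

  col∈span : ∀ {n} (A : Matrix n) t → InColSpan A (col A t)
  col∈span A t = combination∈span A ((+ 1 , t) ∷ [])
    λ r → trans (VecP.lookup∘tabulate _ r) (sym (trans (ℤP.+-identityʳ _) (ℤP.*-identityˡ _)))

  -- Back substitution, from the last row upwards.
  module TriangularKernel {m} (A : Matrix (suc m))
           (upper : ∀ r s → toℕ s ℕ.< toℕ r → entry A r s ≡ + 0)
           (diagonal≢0 : ∀ r → entry A r r ≢ + 0)
           (e : Vec ℤ (suc m))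
           (rows≡0 : ∀ r → r ≢ F.zero → rowDot A e r ≡ + 0) where

    private
      vanishes-below : ∀ s → s ≢ F.zero → (∀ u → toℕ s ℕ.< toℕ u → lookup e u ≡ + 0) → lookup e s ≡ + 0
      vanishes-below s s≢0 above
        with ℤP.i*j≡0⇒i≡0∨j≡0 (entry A s s) (trans (sym (sum-single _ s off-diagonal)) (rows≡0 s s≢0))
        where
        off-diagonal : ∀ u → u ≢ s → entry A s u * lookup e u ≡ + 0
        off-diagonal u u≢s with ℕP.<-cmp (toℕ u) (toℕ s)
        ... | tri< u<s _ _ = cong (_* lookup e u) (upper s u u<s)
        ... | tri≈ _ u≡s _ = ⊥-elim (u≢s (FinP.toℕ-injective u≡s))
        ... | tri> _ _ s<u = trans (cong (entry A s u *_) (above u s<u)) (ℤP.*-zeroʳ (entry A s u))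
      ... | inj₁ ass≡0 = ⊥-elim (diagonal≢0 s ass≡0)
      ... | inj₂ es≡0 = es≡0

      vanishes-within : ∀ d s → m ℕ.≤ toℕ s ℕ.+ d → s ≢ F.zero → lookup e s ≡ + 0
      vanishes-within zero s m≤s s≢0 = vanishes-below s s≢0 λ u s<u →
        ⊥-elim (ℕP.<-irrefl refl (ℕP.<-≤-trans (ℕP.≤-<-trans (ℕP.≤-trans m≤s (ℕP.≤-reflexive (ℕP.+-identityʳ _))) s<u)
                                                (ℕP.≤-pred (FinP.toℕ<n u))))
      vanishes-within (suc d) s m≤s+d s≢0 = vanishes-below s s≢0 λ u s<u →
        vanishes-within d u (ℕP.≤-trans m≤s+d (ℕP.≤-trans (ℕP.≤-reflexive (ℕP.+-suc (toℕ s) d)) (ℕP.+-monoˡ-≤ d s<u)))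
                            λ { refl → ℕP.n≮0 s<u }

    vanishes : ∀ s → s ≢ F.zero → lookup e s ≡ + 0
    vanishes s = vanishes-within m s (ℕP.m≤n+m m (toℕ s))

    rowDot-zero : rowDot A e F.zero ≡ entry A F.zero F.zero * lookup e F.zero
    rowDot-zero = sum-single _ F.zero λ s s≢0 →
      trans (cong (entry A F.zero s *_) (vanishes s s≢0)) (ℤP.*-zeroʳ (entry A F.zero s))

module Enumeration where

  open import Data.Nat using (_+_; _*_; _^_; _<_; _≤_; _≟_; _<?_; s≤s)
  open import Algebra.Properties.Semiring.Sum ℕP.+-*-semiring using (sum; sum-cong-≗; ∑-distrib-+)
  open import Algebra.Properties.CommutativeMonoid.Sum ℕP.*-1-commutativeMonoid
    using () renaming (sum to product)
  open import Data.List using (cartesianProductWith)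

  module _ {A : Set} where

    vectors : ∀ ℓ → (Fin ℓ → List A) → List (Vec A ℓ)
    vectors zero S = Vec.[] List.∷ List.[]
    vectors (suc ℓ) S = cartesianProductWith Vec._∷_ (S F.zero) (vectors ℓ (S ∘ F.suc))

    ∈-vectors⁺ : ∀ ℓ S (v : Vec A ℓ) → (∀ j → lookup v j ∈ S j) → v ∈ vectors ℓ S
    ∈-vectors⁺ zero S Vec.[] _ = here refl
    ∈-vectors⁺ (suc ℓ) S (x Vec.∷ xs) v∈ =
      ∈P.∈-cartesianProductWith⁺ Vec._∷_ (v∈ F.zero) (∈-vectors⁺ ℓ (S ∘ F.suc) xs (v∈ ∘ F.suc))

    ∈-vectors⁻ : ∀ ℓ S (v : Vec A ℓ) → v ∈ vectors ℓ S → ∀ j → lookup v j ∈ S j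
    ∈-vectors⁻ (suc ℓ) S (x Vec.∷ xs) v∈
      with _ , _ , x∈ , xs∈ , refl ← ∈P.∈-cartesianProductWith⁻ Vec._∷_ (S F.zero) (vectors ℓ (S ∘ F.suc)) v∈
      = λ { F.zero → x∈ ; (F.suc j) → ∈-vectors⁻ ℓ (S ∘ F.suc) xs xs∈ j }

    vectors⁺ : ∀ ℓ S → (∀ j → Unique (S j)) → Unique (vectors ℓ S)
    vectors⁺ zero S _ = All.[] AllPairs.∷ AllPairs.[]
    vectors⁺ (suc ℓ) S u =
      UniqueP.cartesianProductWith⁺ Vec._∷_ VecP.∷-injective (u F.zero) (vectors⁺ ℓ (S ∘ F.suc) (u ∘ F.suc))

  length-cartesianProductWith : ∀ {A B C : Set} (f : A → B → C) xs ys →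
    length (cartesianProductWith f xs ys) ≡ length xs * length ys
  length-cartesianProductWith f List.[] ys = refl
  length-cartesianProductWith f (x List.∷ xs) ys =
    trans (ListP.length-++ (List.map (f x) ys))
          (cong₂ _+_ (ListP.length-map (f x) ys) (length-cartesianProductWith f xs ys))

  length-vectors : ∀ {A : Set} ℓ (S : Fin ℓ → List A) → length (vectors ℓ S) ≡ product (length ∘ S)
  length-vectors zero S = refl
  length-vectors (suc ℓ) S =
    trans (length-cartesianProductWith Vec._∷_ (S F.zero) (vectors ℓ (S ∘ F.suc)))
          (cong (length (S F.zero) *_) (length-vectors ℓ (S ∘ F.suc)))

  unique-map⁺ : ∀ {A B : Set} (f : A → B) {xs : List A} → Unique xs →
                (∀ {x y} → x ∈ xs → y ∈ xs → f x ≡ f y → x ≡ y) → Unique (List.map f xs)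
  unique-map⁺ f {List.[]} _ _ = AllPairs.[]
  unique-map⁺ f {x List.∷ xs} (x∉xs AllPairs.∷ u) inj =
    AllP.map⁺ (All.tabulate λ y∈ fx≡fy → All.lookup x∉xs y∈ (inj (here refl) (there y∈) fx≡fy))
    AllPairs.∷ unique-map⁺ f u λ x∈ y∈ → inj (there x∈) (there y∈)

  product-^ : ∀ {ℓ} a (g : Fin ℓ → ℕ) → product (λ j → a ^ g j) ≡ a ^ sum g
  product-^ {zero} a g = refl
  product-^ {suc ℓ} a g = trans (cong (a ^ g F.zero *_) (product-^ a (g ∘ F.suc)))
                                (sym (ℕP.^-distribˡ-+-* a (g F.zero) (sum (g ∘ F.suc))))

  sum-zero : ∀ {ℓ} (f : Fin ℓ → ℕ) → (∀ j → f j ≡ 0) → sum f ≡ 0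
  sum-zero {zero} f _ = refl
  sum-zero {suc ℓ} f f≡0 = cong₂ _+_ (f≡0 F.zero) (sum-zero (f ∘ F.suc) (f≡0 ∘ F.suc))

  sum-const-1 : ∀ ℓ → sum (λ (_ : Fin ℓ) → 1) ≡ ℓ
  sum-const-1 zero = refl
  sum-const-1 (suc ℓ) = cong suc (sum-const-1 ℓ)

  sum-complement : ∀ {ℓ} (f g : Fin ℓ → ℕ) → (∀ j → f j + g j ≡ 1) → sum f + sum g ≡ ℓ
  sum-complement {ℓ} f g f+g≡1 = trans (sym (∑-distrib-+ f g)) (trans (sum-cong-≗ f+g≡1) (sum-const-1 ℓ))

  𝟙 : ∀ {P : Set} → Dec P → ℕ
  𝟙 (yes _) = 1
  𝟙 (no _) = 0

  𝟙-yes : ∀ {P : Set} (d : Dec P) → P → 𝟙 d ≡ 1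
  𝟙-yes (yes _) _ = refl
  𝟙-yes (no ¬p) p = ⊥-elim (¬p p)

  𝟙-no : ∀ {P : Set} (d : Dec P) → ¬ P → 𝟙 d ≡ 0
  𝟙-no (yes p) ¬p = ⊥-elim (¬p p)
  𝟙-no (no _) _ = refl

  sum-𝟙-≡ : ∀ ℓ a → a < ℓ → sum (λ (j : Fin ℓ) → 𝟙 (toℕ j ≟ a)) ≡ 1
  sum-𝟙-≡ (suc ℓ) zero _ =
    cong suc (sum-zero {ℓ} (λ j → 𝟙 (suc (toℕ j) ≟ 0)) λ j → 𝟙-no (suc (toℕ j) ≟ 0) λ ())
  sum-𝟙-≡ (suc ℓ) (suc a) (s≤s a<ℓ) = trans (sum-cong-≗ {ℓ} shift) (sum-𝟙-≡ ℓ a a<ℓ)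
    where
    shift : ∀ j → 𝟙 (suc (toℕ j) ≟ suc a) ≡ 𝟙 (toℕ j ≟ a)
    shift j with toℕ j ≟ a
    ... | yes j≡a = 𝟙-yes (suc (toℕ j) ≟ suc a) (cong suc j≡a)
    ... | no j≢a = 𝟙-no (suc (toℕ j) ≟ suc a) (j≢a ∘ ℕP.suc-injective)

  sum-𝟙-< : ∀ ℓ a → a ≤ ℓ → sum (λ (j : Fin ℓ) → 𝟙 (toℕ j <? a)) ≡ a
  sum-𝟙-< ℓ zero _ = sum-zero {ℓ} (λ j → 𝟙 (toℕ j <? 0)) λ j → 𝟙-no (toℕ j <? 0) λ ()
  sum-𝟙-< (suc ℓ) (suc a) (s≤s a≤ℓ) = cong suc (trans (sum-cong-≗ {ℓ} shift) (sum-𝟙-< ℓ a a≤ℓ))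
    where
    shift : ∀ j → 𝟙 (suc (toℕ j) <? suc a) ≡ 𝟙 (toℕ j <? a)
    shift j with toℕ j <? a
    ... | yes j<a = 𝟙-yes (suc (toℕ j) <? suc a) (s≤s j<a)
    ... | no j≮a = 𝟙-no (suc (toℕ j) <? suc a) λ { (s≤s j<a) → j≮a j<a }

-- K is the 0-based position of the second entry 2 of α, i.e. K = k − 1.
module Shape (p′ m K β : ℕ) (K≢0 : K ≢ 0) (2+K≤m : 2 ℕ.+ K ℕ.≤ m) (1<β : 1 ℕ.< β) where

  open import Data.Integer using (ℤ; +_; _+_; _*_; _-_; -_)
  open import Data.List using ([]; _∷_)
  open ColumnSpan

  p : ℕ
  p = suc (suc p′)

  N : ℕ
  N = suc m

  α : ℕ → ℕ
  α = alphaEntry m (suc K) β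

  K<m∸1 : K ℕ.< m ℕ.∸ 1
  K<m∸1 = ℕP.∸-monoˡ-≤ 1 2+K≤m

  K<m : K ℕ.< m
  K<m = ℕP.<-≤-trans K<m∸1 (ℕP.m∸n≤m m 1)

  0≢m : 0 ≢ m
  0≢m 0≡m = ℕP.<⇒≢ (ℕP.≤-<-trans ℕ.z≤n K<m) 0≡m

  K≢m : K ≢ m
  K≢m = ℕP.<⇒≢ K<m

  m<N : m ℕ.< N
  m<N = ℕP.n<1+n m

  K<N : K ℕ.< N
  K<N = ℕP.<-trans K<m m<N

  α-zero : α 0 ≡ 2
  α-zero = refl

  α-K : α K ≡ 2
  α-K with K ℕ.≟ 0
  ... | yes K≡0 = ⊥-elim (K≢0 K≡0)
  ... | no _ with K ℕ.≟ K
  ...   | yes _ = refl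
  ...   | no K≢K = ⊥-elim (K≢K refl)

  α-m∸1 : α (m ℕ.∸ 1) ≡ β
  α-m∸1 with m ℕ.∸ 1 ℕ.≟ 0
  ... | yes m∸1≡0 = ⊥-elim (ℕP.<⇒≢ (ℕP.≤-<-trans ℕ.z≤n K<m∸1) (sym m∸1≡0))
  ... | no _ with m ℕ.∸ 1 ℕ.≟ K
  ...   | yes m∸1≡K = ⊥-elim (ℕP.<⇒≢ K<m∸1 (sym m∸1≡K))
  ...   | no _ with m ℕ.∸ 1 ℕ.≟ m ℕ.∸ 1
  ...     | yes _ = refl
  ...     | no ≢ = ⊥-elim (≢ refl)

  α-other : ∀ i → i ≢ 0 → i ≢ K → i ≢ m ℕ.∸ 1 → α i ≡ 1
  α-other i i≢0 i≢K i≢m∸1 with i ℕ.≟ 0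
  ... | yes i≡0 = ⊥-elim (i≢0 i≡0)
  ... | no _ with i ℕ.≟ K
  ...   | yes i≡K = ⊥-elim (i≢K i≡K)
  ...   | no _ with i ℕ.≟ m ℕ.∸ 1
  ...     | yes i≡m∸1 = ⊥-elim (i≢m∸1 i≡m∸1)
  ...     | no _ = refl

  α-positive : ∀ i → 1 ℕ.≤ α i
  α-positive i with i ℕ.≟ 0
  ... | yes _ = ℕ.s≤s ℕ.z≤n
  ... | no _ with i ℕ.≟ K
  ...   | yes _ = ℕ.s≤s ℕ.z≤n
  ...   | no _ with i ℕ.≟ m ℕ.∸ 1
  ...     | yes _ = ℕP.<⇒≤ 1<β
  ...     | no _ = ℕ.s≤s ℕ.z≤n

  lookup-alpha : ∀ (i : Fin m) → lookup (alpha m (suc K) β) i ≡ α (toℕ i)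
  lookup-alpha i = VecP.lookup∘tabulate (λ i′ → α (toℕ i′)) i

  -- Row r of an irreducible subring matrix has diagonal entry p · bound r and
  -- off-diagonal entries p · a with a < bound r.
  bound : Fin N → ℕ
  bound r = p ℕ.^ (α (toℕ r) ℕ.∸ 1)

  p*bound : ∀ r → p ℕ.* bound r ≡ p ℕ.^ α (toℕ r)
  p*bound r with α (toℕ r) | α-positive (toℕ r)
  ... | suc a | _ = refl

  bound>0 : ∀ r → 0 ℕ.< bound r
  bound>0 r = ℕP.m^n>0 p (α (toℕ r) ℕ.∸ 1)

  bound≡p : ∀ r → α (toℕ r) ≡ 2 → bound r ≡ p
  bound≡p r α≡2 = trans (cong (λ a → p ℕ.^ (a ℕ.∸ 1)) α≡2) (ℕP.*-identityʳ p)

  toℕ≤m : ∀ (j : Fin N) → toℕ j ℕ.≤ m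
  toℕ≤m j = ℕP.≤-pred (FinP.toℕ<n j)

  i0 iK ilast : Fin N
  i0 = F.zero
  iK = F.fromℕ< (K<N)
  ilast = F.fromℕ m

  toℕ-iK : toℕ iK ≡ K
  toℕ-iK = FinP.toℕ-fromℕ< _

  iK≢0 : toℕ iK ≢ 0
  iK≢0 K≡0 = K≢0 (trans (sym toℕ-iK) K≡0)

  iK≢m : toℕ iK ≢ m
  iK≢m K≡m = K≢m (trans (sym toℕ-iK) K≡m)

  toℕ-ilast : toℕ ilast ≡ m
  toℕ-ilast = FinP.toℕ-fromℕ m

  -- Coefficient a_rj of the matrix determined by rows B (row 0) and C (row K).
  -- On the diagonal it is bound r, so that the entry p · a_rr is the diagonal entry.
  coeff : Vec ℕ N → Vec ℕ N → Fin N → Fin N → ℕ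
  coeff B C r j with toℕ r ℕ.≟ toℕ j
  ... | yes _ = bound r
  ... | no _ with toℕ r ℕ.≟ 0
  ...   | yes _ = lookup B j
  ...   | no _ with toℕ r ℕ.≟ K
  ...     | yes _ = lookup C j
  ...     | no _ = 0

  entryOf : Vec ℕ N → Vec ℕ N → Fin N → Fin N → ℤ
  entryOf B C r j with toℕ j ℕ.≟ m
  ... | yes _ = + 1
  ... | no _ = + (p ℕ.* coeff B C r j)

  matrix : Vec ℕ N → Vec ℕ N → Matrix N
  matrix B C = tabulate λ r → tabulate λ j → entryOf B C r j

  entry-matrix : ∀ B C r j → entry (matrix B C) r j ≡ entryOf B C r j
  entry-matrix B C r j =
    trans (cong (λ row → lookup row j) (VecP.lookup∘tabulate (λ r′ → tabulate (entryOf B C r′)) r))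
          (VecP.lookup∘tabulate (entryOf B C r) j)

  module Coefficients (B C : Vec ℕ N) where

    coeff-diagonal : ∀ r j → toℕ r ≡ toℕ j → coeff B C r j ≡ bound r
    coeff-diagonal r j r≡j with toℕ r ℕ.≟ toℕ j
    ... | yes _ = refl
    ... | no r≢j = ⊥-elim (r≢j r≡j)

    coeff-row0 : ∀ r j → toℕ r ≡ 0 → toℕ j ≢ 0 → coeff B C r j ≡ lookup B j
    coeff-row0 r j r≡0 j≢0 with toℕ r ℕ.≟ toℕ j
    ... | yes r≡j = ⊥-elim (j≢0 (trans (sym r≡j) r≡0))
    ... | no _ with toℕ r ℕ.≟ 0
    ...   | yes _ = refl
    ...   | no r≢0 = ⊥-elim (r≢0 r≡0)

    coeff-rowK : ∀ r j → toℕ r ≡ K → toℕ j ≢ K → coeff B C r j ≡ lookup C j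
    coeff-rowK r j r≡K j≢K with toℕ r ℕ.≟ toℕ j
    ... | yes r≡j = ⊥-elim (j≢K (trans (sym r≡j) r≡K))
    ... | no _ with toℕ r ℕ.≟ 0
    ...   | yes r≡0 = ⊥-elim (K≢0 (trans (sym r≡K) r≡0))
    ...   | no _ with toℕ r ℕ.≟ K
    ...     | yes _ = refl
    ...     | no r≢K = ⊥-elim (r≢K r≡K)

    coeff-otherRow : ∀ r j → toℕ r ≢ toℕ j → toℕ r ≢ 0 → toℕ r ≢ K → coeff B C r j ≡ 0
    coeff-otherRow r j r≢j r≢0 r≢K with toℕ r ℕ.≟ toℕ j
    ... | yes r≡j = ⊥-elim (r≢j r≡j)
    ... | no _ with toℕ r ℕ.≟ 0
    ...   | yes r≡0 = ⊥-elim (r≢0 r≡0)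
    ...   | no _ with toℕ r ℕ.≟ K
    ...     | yes r≡K = ⊥-elim (r≢K r≡K)
    ...     | no _ = refl

    entryOf-last : ∀ r j → toℕ j ≡ m → entryOf B C r j ≡ + 1
    entryOf-last r j j≡m with toℕ j ℕ.≟ m
    ... | yes _ = refl
    ... | no j≢m = ⊥-elim (j≢m j≡m)

    entryOf-coeff : ∀ r j → toℕ j ≢ m → entryOf B C r j ≡ + p * + coeff B C r j
    entryOf-coeff r j j≢m with toℕ j ℕ.≟ m
    ... | yes j≡m = ⊥-elim (j≢m j≡m)
    ... | no _ = ℤP.pos-* p (coeff B C r j)

  -- The coordinates of B and C that the matrix does not see are normalised to 0.
  CanonicalB : Vec ℕ N → Set
  CanonicalB B = ∀ j → toℕ j ≡ 0 ⊎ toℕ j ≡ m → lookup B j ≡ 0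

  CanonicalC : Vec ℕ N → Set
  CanonicalC C = ∀ j → toℕ j ℕ.≤ K ⊎ toℕ j ≡ m → lookup C j ≡ 0

  Ordinary : Fin N → Set
  Ordinary j = toℕ j ≢ 0 × toℕ j ≢ K × toℕ j ≢ m

  module Entries (B C : Vec ℕ N) (canB : CanonicalB B) (canC : CanonicalC C) where
    open Coefficients B C public

    P : ℤ
    P = + p

    E : Fin N → Fin N → ℤ
    E = entryOf B C

    b c : Fin N → ℤ
    b j = + lookup B j
    c j = + lookup C j

    entryOf-zero : ∀ r j → toℕ j ≢ m → coeff B C r j ≡ 0 → E r j ≡ + 0
    entryOf-zero r j j≢m a≡0 = trans (entryOf-coeff r j j≢m) (trans (cong (λ a → P * + a) a≡0) (ℤP.*-zeroʳ P))

    entryOf-otherRow : ∀ r j → toℕ j ≢ m → toℕ r ≢ toℕ j → toℕ r ≢ 0 → toℕ r ≢ K → E r j ≡ + 0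
    entryOf-otherRow r j j≢m r≢j r≢0 r≢K = entryOf-zero r j j≢m (coeff-otherRow r j r≢j r≢0 r≢K)

    entryOf-col0 : ∀ r j → toℕ j ≡ 0 → toℕ r ≢ 0 → E r j ≡ + 0
    entryOf-col0 r j j≡0 r≢0 with toℕ r ℕ.≟ K
    ... | yes r≡K = entryOf-zero r j j≢m (trans (coeff-rowK r j r≡K λ j≡K → K≢0 (trans (sym j≡K) j≡0))
                                                  (canC j (inj₁ (subst (ℕ._≤ K) (sym j≡0) ℕ.z≤n))))
      where
      j≢m : toℕ j ≢ m
      j≢m j≡m = 0≢m (trans (sym j≡0) j≡m)
    ... | no r≢K = entryOf-otherRow r j (λ j≡m → 0≢m (trans (sym j≡0) j≡m)) (λ r≡j → r≢0 (trans r≡j j≡0)) r≢0 r≢K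

    entryOf-colK : ∀ r j → toℕ j ≡ K → toℕ r ≢ 0 → toℕ r ≢ K → E r j ≡ + 0
    entryOf-colK r j j≡K r≢0 r≢K =
      entryOf-otherRow r j (λ j≡m → K≢m (trans (sym j≡K) j≡m)) (λ r≡j → r≢K (trans r≡j j≡K)) r≢0 r≢K

    entryOf-diagonal : ∀ r → toℕ r ≢ m → E r r ≡ P * + bound r
    entryOf-diagonal r r≢m = trans (entryOf-coeff r r r≢m) (cong (λ a → P * + a) (coeff-diagonal r r refl))

    entryOf-00 : E i0 i0 ≡ P * P
    entryOf-00 = trans (entryOf-diagonal i0 0≢m) (cong (λ a → P * + a) (bound≡p i0 α-zero))

    entryOf-KK : E iK iK ≡ P * P
    entryOf-KK = trans (entryOf-diagonal iK iK≢m)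
                       (cong (λ a → P * + a) (bound≡p iK (trans (cong α toℕ-iK) α-K)))

    entryOf-row0 : ∀ j → toℕ j ≢ 0 → toℕ j ≢ m → E i0 j ≡ P * b j
    entryOf-row0 j j≢0 j≢m = trans (entryOf-coeff i0 j j≢m) (cong (λ a → P * + a) (coeff-row0 i0 j refl j≢0))

    entryOf-rowK : ∀ j → toℕ j ≢ K → toℕ j ≢ m → E iK j ≡ P * c j
    entryOf-rowK j j≢K j≢m = trans (entryOf-coeff iK j j≢m) (cong (λ a → P * + a) (coeff-rowK iK j toℕ-iK j≢K))

    entryOf-lower : ∀ r j → toℕ j ℕ.< toℕ r → E r j ≡ + 0
    entryOf-lower r j j<r with toℕ r ℕ.≟ K
    ... | yes r≡K = entryOf-zero r j j≢m (trans (coeff-rowK r j r≡K λ j≡K → ℕP.<⇒≢ j<r (trans j≡K (sym r≡K)))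
                                                 (canC j (inj₁ (ℕP.<⇒≤ (subst (toℕ j ℕ.<_) r≡K j<r)))))
      where
      j≢m : toℕ j ≢ m
      j≢m j≡m = ℕP.<⇒≱ j<r (subst (toℕ r ℕ.≤_) (sym j≡m) (toℕ≤m r))
    ... | no r≢K = entryOf-otherRow r j (λ j≡m → ℕP.<⇒≱ j<r (subst (toℕ r ℕ.≤_) (sym j≡m) (toℕ≤m r)))
                     (λ r≡j → ℕP.<⇒≢ j<r (sym r≡j)) (λ r≡0 → ℕP.n≮0 (subst (toℕ j ℕ.<_) r≡0 j<r)) r≢K

    entryOf-diagonal≢0 : ∀ r → E r r ≢ + 0
    entryOf-diagonal≢0 r Err≡0 = by-cases (toℕ r ℕ.≟ m)
      where
      factors≢0 : P ≡ + 0 ⊎ + bound r ≡ + 0 → ⊥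
      factors≢0 (inj₁ ())
      factors≢0 (inj₂ bound≡0) = ℕP.<⇒≢ (bound>0 r) (sym (ℤP.+-injective bound≡0))
      1≢0 : + 1 ≢ + 0
      1≢0 ()
      by-cases : Dec (toℕ r ≡ m) → ⊥
      by-cases (yes r≡m) = 1≢0 (trans (sym (entryOf-last r r r≡m)) Err≡0)
      by-cases (no r≢m) = factors≢0 (ℤP.i*j≡0⇒i≡0∨j≡0 P (trans (sym (entryOf-diagonal r r≢m)) Err≡0))

    M : Matrix N
    M = matrix B C

    combineE : Combination N → Fin N → ℤ
    combineE [] r = + 0
    combineE ((a , t) ∷ l) r = a * E r t + combineE l r

    combine-matrix : ∀ l r → combine M l r ≡ combineE l r
    combine-matrix [] r = refl
    combine-matrix ((a , t) ∷ l) r = cong₂ _+_ (cong (a *_) (entry-matrix B C r t)) (combine-matrix l r)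

    ColumnProduct : Fin N → Fin N → Set
    ColumnProduct i j = Σ (Combination N) λ l → ∀ r → E r i * E r j ≡ combineE l r

    columnProduct∈span : ∀ i j → ColumnProduct i j → InColSpan M (col M i ⊙ col M j)
    columnProduct∈span i j (l , eq) = combination∈span M l λ r →
      trans (lookup-col⊙col M i j r)
            (trans (cong₂ _*_ (entry-matrix B C r i) (entry-matrix B C r j)) (trans (eq r) (sym (combine-matrix l r))))

    columnProduct-swap : ∀ i j → ColumnProduct j i → ColumnProduct i j
    columnProduct-swap i j (l , eq) = l , λ r → trans (ℤP.*-comm (E r i) (E r j)) (eq r)

    -- For ordinary i, j: away from row 0, col i ⊙ col j = p · x i j • col i + y i j • col K.
    xOf : Fin N → {Q : Set} → Dec Q → ℤ
    xOf i (yes _) = + bound i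
    xOf i (no _) = + 0

    yOf : Fin N → Fin N → {Q : Set} → Dec Q → ℤ
    yOf i j (yes _) = c i * c i - c i * + bound i
    yOf i j (no _) = c i * c j

    x y : Fin N → Fin N → ℤ
    x i j = xOf i (toℕ i ℕ.≟ toℕ j)
    y i j = yOf i j (toℕ i ℕ.≟ toℕ j)

    x-diagonal : ∀ i → x i i ≡ + bound i
    x-diagonal i with toℕ i ℕ.≟ toℕ i
    ... | yes _ = refl
    ... | no i≢i = ⊥-elim (i≢i refl)

    x-offDiagonal : ∀ i j → toℕ i ≢ toℕ j → x i j ≡ + 0
    x-offDiagonal i j i≢j with toℕ i ℕ.≟ toℕ j
    ... | yes i≡j = ⊥-elim (i≢j i≡j)
    ... | no _ = refl

    y-diagonal : ∀ i → y i i ≡ c i * c i - c i * + bound i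
    y-diagonal i with toℕ i ℕ.≟ toℕ i
    ... | yes _ = refl
    ... | no i≢i = ⊥-elim (i≢i refl)

    y-offDiagonal : ∀ i j → toℕ i ≢ toℕ j → y i j ≡ c i * c j
    y-offDiagonal i j i≢j with toℕ i ℕ.≟ toℕ j
    ... | yes i≡j = ⊥-elim (i≢j i≡j)
    ... | no _ = refl

    ProductCondition : Set
    ProductCondition = ∀ i j → Ordinary i → Ordinary j → ∃ λ q → b iK * y i j ≡ P * q

    ordinaryCombination : Fin N → Fin N → Combination N
    ordinaryCombination i j = (P * x i j , i) ∷ (y i j , iK) ∷ []

    -- Row 0 of col i ⊙ col j minus the ordinary combination is p · defect i j.
    defect : Fin N → Fin N → ℤ
    defect i j = P * (b i * b j) - P * x i j * b i - y i j * b iK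

    ordinary-rowK : ∀ i j → Ordinary i → Ordinary j → E iK i * E iK j ≡ combineE (ordinaryCombination i j) iK
    ordinary-rowK i j (_ , i≢K , i≢m) (_ , j≢K , j≢m) = by-cases (toℕ i ℕ.≟ toℕ j)
      where
      diagonal : ∀ p c a → (p * c) * (p * c) ≡ p * a * (p * c) + ((c * c - c * a) * (p * p) + + 0)
      diagonal = solve-∀
      offDiagonal : ∀ p cᵢ cⱼ → (p * cᵢ) * (p * cⱼ) ≡ p * + 0 * (p * cᵢ) + (cᵢ * cⱼ * (p * p) + + 0)
      offDiagonal = solve-∀
      by-cases : Dec (toℕ i ≡ toℕ j) → E iK i * E iK j ≡ combineE (ordinaryCombination i j) iK
      by-cases (yes i≡j) with refl ← FinP.toℕ-injective i≡j
        rewrite entryOf-rowK i i≢K i≢m | entryOf-KK | x-diagonal i | y-diagonal i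
        = diagonal P (c i) (+ bound i)
      by-cases (no i≢j)
        rewrite entryOf-rowK i i≢K i≢m | entryOf-rowK j j≢K j≢m | entryOf-KK | x-offDiagonal i j i≢j | y-offDiagonal i j i≢j
        = offDiagonal P (c i) (c j)

    ordinary-row-i : ∀ i j → Ordinary i → Ordinary j → E i i * E i j ≡ combineE (ordinaryCombination i j) i
    ordinary-row-i i j (i≢0 , i≢K , i≢m) (_ , _ , j≢m) = by-cases (toℕ i ℕ.≟ toℕ j)
      where
      diagonal : ∀ p a v → (p * a) * (p * a) ≡ p * a * (p * a) + (v * + 0 + + 0)
      diagonal = solve-∀
      offDiagonal : ∀ p a v → a * + 0 ≡ p * + 0 * a + (v * + 0 + + 0)
      offDiagonal = solve-∀
      by-cases : Dec (toℕ i ≡ toℕ j) → E i i * E i j ≡ combineE (ordinaryCombination i j) i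
      by-cases (yes i≡j) with refl ← FinP.toℕ-injective i≡j
        rewrite entryOf-diagonal i i≢m | x-diagonal i | entryOf-colK i iK toℕ-iK i≢0 i≢K
        = diagonal P (+ bound i) (y i i)
      by-cases (no i≢j)
        rewrite entryOf-otherRow i j j≢m i≢j i≢0 i≢K | x-offDiagonal i j i≢j | entryOf-colK i iK toℕ-iK i≢0 i≢K
        = offDiagonal P (E i i) (y i j)

    ordinary-rows≢0 : ∀ i j → Ordinary i → Ordinary j →
                      ∀ r → toℕ r ≢ 0 → E r i * E r j ≡ combineE (ordinaryCombination i j) r
    ordinary-rows≢0 i j oi@(_ , _ , i≢m) oj r r≢0 with toℕ r ℕ.≟ K | toℕ r ℕ.≟ toℕ i
    ... | yes r≡K | _ rewrite FinP.toℕ-injective {i = r} {j = iK} (trans r≡K (sym toℕ-iK)) = ordinary-rowK i j oi oj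
    ... | no _ | yes r≡i rewrite FinP.toℕ-injective r≡i = ordinary-row-i i j oi oj
    ... | no r≢K | no r≢i rewrite entryOf-otherRow r i i≢m r≢i r≢0 r≢K | entryOf-colK r iK toℕ-iK r≢0 r≢K
      = identity P (x i j) (E r j) (y i j)
      where
      identity : ∀ p a e v → + 0 * e ≡ p * a * + 0 + (v * + 0 + + 0)
      identity = solve-∀

    ordinary-row0 : ∀ i j → Ordinary i → Ordinary j →
                    E i0 i * E i0 j ≡ combineE (ordinaryCombination i j) i0 + P * defect i j
    ordinary-row0 i j (i≢0 , _ , i≢m) (j≢0 , _ , j≢m)
      rewrite entryOf-row0 i i≢0 i≢m | entryOf-row0 j j≢0 j≢m | entryOf-row0 iK iK≢0 iK≢m
      = identity P (b i) (b j) (x i j) (y i j) (b iK)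
      where
      identity : ∀ p bᵢ bⱼ a v bK →
                 (p * bᵢ) * (p * bⱼ) ≡ p * a * (p * bᵢ) + (v * (p * bK) + + 0) + p * (p * (bᵢ * bⱼ) - p * a * bᵢ - v * bK)
      identity = solve-∀

    ordinaryProduct : ProductCondition → ∀ i j → Ordinary i → Ordinary j → ColumnProduct i j
    ordinaryProduct condition i j oi oj = l , row
      where
      q = proj₁ (condition i j oi oj)
      bK*y≡P*q = proj₂ (condition i j oi oj)
      d = b i * b j - x i j * b i - q
      l = (P * x i j , i) ∷ (y i j , iK) ∷ (d , i0) ∷ []
      defect≡P*d : defect i j ≡ P * d
      defect≡P*d = trans (cong (λ t → P * (b i * b j) - P * x i j * b i - t) (trans (ℤP.*-comm (y i j) (b iK)) bK*y≡P*q))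
                         (identity P (b i * b j) (x i j) (b i) q)
        where
        identity : ∀ p u a bᵢ w → p * u - p * a * bᵢ - p * w ≡ p * (u - a * bᵢ - w)
        identity = solve-∀
      row : ∀ r → E r i * E r j ≡ combineE l r
      row r with toℕ r ℕ.≟ 0
      ... | no r≢0 rewrite entryOf-col0 r i0 refl r≢0 =
        trans (ordinary-rows≢0 i j oi oj r r≢0) (identity (P * x i j * E r i) (y i j * E r iK) d)
        where
        identity : ∀ u v w → u + (v + + 0) ≡ u + (v + (w * + 0 + + 0))
        identity = solve-∀
      ... | yes r≡0 rewrite FinP.toℕ-injective {i = r} {j = i0} r≡0 | entryOf-00 =
        trans (ordinary-row0 i j oi oj) (trans (cong (λ t → combineE (ordinaryCombination i j) i0 + P * t) defect≡P*d)
                                               (identity (P * x i j * E i0 i) (y i j * E i0 iK) P d))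
        where
        identity : ∀ u v p w → u + (v + + 0) + p * (p * w) ≡ u + (v + (w * (p * p) + + 0))
        identity = solve-∀

    lastProduct : ∀ i j → toℕ i ≡ m → ColumnProduct i j
    lastProduct i j i≡m = (+ 1 , j) ∷ [] , λ r →
      trans (cong (_* E r j) (entryOf-last r i i≡m)) (sym (ℤP.+-identityʳ (+ 1 * E r j)))

    zeroProduct : ∀ i j → toℕ i ≡ 0 → ColumnProduct i j
    zeroProduct i j i≡0 = (E i0 j , i) ∷ [] , row
      where
      row : ∀ r → E r i * E r j ≡ E i0 j * E r i + + 0
      row r with toℕ r ℕ.≟ 0
      ... | yes r≡0 rewrite FinP.toℕ-injective {i = r} {j = i0} r≡0 =
        trans (ℤP.*-comm (E i0 i) (E i0 j)) (sym (ℤP.+-identityʳ _))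
      ... | no r≢0 rewrite entryOf-col0 r i i≡0 r≢0 = identity (E r j) (E i0 j)
        where
        identity : ∀ e w → + 0 * e ≡ w * + 0 + + 0
        identity = solve-∀

    KProduct : ∀ i j → toℕ i ≡ K → toℕ j ≢ m → toℕ j ≢ 0 → ColumnProduct i j
    KProduct i j i≡K j≢m j≢0 = l , row
      where
      i≢0 : toℕ i ≢ 0
      i≢0 i≡0 = K≢0 (trans (sym i≡K) i≡0)
      i≢m : toℕ i ≢ m
      i≢m i≡m = K≢m (trans (sym i≡K) i≡m)
      v = b i * (+ coeff B C i0 j - + coeff B C i j)
      l = (E i j , i) ∷ (v , i0) ∷ []
      row : ∀ r → E r i * E r j ≡ combineE l r
      row r with toℕ r ℕ.≟ 0 | toℕ r ℕ.≟ K
      ... | yes r≡0 | _ rewrite FinP.toℕ-injective {i = r} {j = i0} r≡0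
        | entryOf-row0 i i≢0 i≢m | entryOf-00 | entryOf-coeff i0 j j≢m | entryOf-coeff i j j≢m
        = identity P (b i) (+ coeff B C i0 j) (+ coeff B C i j)
        where
        identity : ∀ p bᵢ a₀ aᵢ → (p * bᵢ) * (p * a₀) ≡ (p * aᵢ) * (p * bᵢ) + ((bᵢ * (a₀ - aᵢ)) * (p * p) + + 0)
        identity = solve-∀
      ... | no r≢0 | yes r≡K rewrite FinP.toℕ-injective {i = r} {j = i} (trans r≡K (sym i≡K)) | entryOf-col0 i i0 refl i≢0
        = identity (E i i) (E i j) v
        where
        identity : ∀ u w v → u * w ≡ w * u + (v * + 0 + + 0)
        identity = solve-∀
      ... | no r≢0 | no r≢K rewrite entryOf-colK r i i≡K r≢0 r≢K | entryOf-col0 r i0 refl r≢0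
        = identity (E r j) (E i j) v
        where
        identity : ∀ e w v → + 0 * e ≡ w * + 0 + (v * + 0 + + 0)
        identity = solve-∀

    columnProduct : ProductCondition → ∀ i j → ColumnProduct i j
    columnProduct condition i j = by-last (toℕ i ℕ.≟ m) (toℕ j ℕ.≟ m)
      where
      by-K : toℕ i ≢ 0 → toℕ j ≢ 0 → toℕ i ≢ m → toℕ j ≢ m → Dec (toℕ i ≡ K) → Dec (toℕ j ≡ K) → ColumnProduct i j
      by-K _ j≢0 _ j≢m (yes i≡K) _ = KProduct i j i≡K j≢m j≢0
      by-K i≢0 _ i≢m _ (no _) (yes j≡K) = columnProduct-swap i j (KProduct j i j≡K i≢m i≢0)
      by-K i≢0 j≢0 i≢m j≢m (no i≢K) (no j≢K) = ordinaryProduct condition i j (i≢0 , i≢K , i≢m) (j≢0 , j≢K , j≢m)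
      by-zero : toℕ i ≢ m → toℕ j ≢ m → Dec (toℕ i ≡ 0) → Dec (toℕ j ≡ 0) → ColumnProduct i j
      by-zero _ _ (yes i≡0) _ = zeroProduct i j i≡0
      by-zero _ _ (no _) (yes j≡0) = columnProduct-swap i j (zeroProduct j i j≡0)
      by-zero i≢m j≢m (no i≢0) (no j≢0) = by-K i≢0 j≢0 i≢m j≢m (toℕ i ℕ.≟ K) (toℕ j ℕ.≟ K)
      by-last : Dec (toℕ i ≡ m) → Dec (toℕ j ≡ m) → ColumnProduct i j
      by-last (yes i≡m) _ = lastProduct i j i≡m
      by-last (no _) (yes j≡m) = columnProduct-swap i j (lastProduct j i j≡m)
      by-last (no i≢m) (no j≢m) = by-zero i≢m j≢m (toℕ i ℕ.≟ 0) (toℕ j ℕ.≟ 0)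

    closed-if-condition : ProductCondition → SubringClosed M
    closed-if-condition condition =
      closed-from-column-products M λ i j → columnProduct∈span i j (columnProduct condition i j)

    -- Closure puts col i ⊙ col j in the span; subtracting the ordinary combination leaves a
    -- vector vanishing outside row 0, whose coefficient vector is supported on column 0 by
    -- back substitution. Row 0 then reads p · defect = p² e₀.
    defect-divisible : SubringClosed M → ∀ i j → Ordinary i → Ordinary j → ∃ λ e₀ → defect i j ≡ P * e₀
    defect-divisible closed i j oi oj = e₀ , ℤP.*-cancelˡ-≡ P _ _ P*defect
      where
      l = ordinaryCombination i j
      product∈span = closed (col M i) (col M j) (col∈span M i) (col∈span M j)
      e : Vec ℤ N
      e = Vec.zipWith _-_ (proj₁ product∈span) (tabulate (coefficients l))
      row : ∀ r → rowDot M e r ≡ E r i * E r j - combineE l r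
      row r = trans (rowDot-zipWith-- M (proj₁ product∈span) (tabulate (coefficients l)) r) (cong₂ _-_
        (trans (mulVec≡⇒rowDot≡ M (proj₂ product∈span) r)
               (trans (lookup-col⊙col M i j r) (cong₂ _*_ (entry-matrix B C r i) (entry-matrix B C r j))))
        (trans (rowDot-coefficients M l r) (combine-matrix l r)))
      rows≢0 : ∀ r → r ≢ F.zero → rowDot M e r ≡ + 0
      rows≢0 r r≢0 = trans (row r) (trans (cong (_- combineE l r) (ordinary-rows≢0 i j oi oj r toℕr≢0))
                                          (ℤP.+-inverseʳ (combineE l r)))
        where
        toℕr≢0 : toℕ r ≢ 0
        toℕr≢0 r≡0 = r≢0 (FinP.toℕ-injective {j = F.zero} r≡0)
      module Kernel = TriangularKernel M (λ r s s<r → trans (entry-matrix B C r s) (entryOf-lower r s s<r))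
                        (λ r Mrr≡0 → entryOf-diagonal≢0 r (trans (sym (entry-matrix B C r r)) Mrr≡0)) e rows≢0
      e₀ = lookup e F.zero
      cancel : ∀ u v w → u ≡ v + w → u - v ≡ w
      cancel u v w u≡v+w = trans (cong (_- v) u≡v+w) (identity v w)
        where
        identity : ∀ v w → v + w - v ≡ w
        identity = solve-∀
      P*defect : P * defect i j ≡ P * (P * e₀)
      P*defect = begin
          P * defect i j
        ≡⟨ sym (cancel _ _ _ (ordinary-row0 i j oi oj)) ⟩
          E i0 i * E i0 j - combineE l i0
        ≡⟨ sym (row i0) ⟩
          rowDot M e i0
        ≡⟨ Kernel.rowDot-zero ⟩
          entry M i0 i0 * e₀
        ≡⟨ cong (_* e₀) (trans (entry-matrix B C i0 i0) entryOf-00) ⟩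
          P * P * e₀
        ≡⟨ ℤP.*-assoc P P e₀ ⟩
          P * (P * e₀) ∎
        where open ≡-Reasoning

    condition-if-closed : SubringClosed M → ProductCondition
    condition-if-closed closed i j oi oj = b i * b j - x i j * b i - e₀ ,
      trans (unfold P (b i) (b j) (x i j) (y i j) (b iK))
            (trans (cong (λ t → P * (b i * b j) - P * x i j * b i - t) defect≡P*e₀) (fold P (b i) (b j) (x i j) e₀))
      where
      e₀ = proj₁ (defect-divisible closed i j oi oj)
      defect≡P*e₀ = proj₂ (defect-divisible closed i j oi oj)
      unfold : ∀ p bᵢ bⱼ a v bK → bK * v ≡ p * (bᵢ * bⱼ) - p * a * bᵢ - (p * (bᵢ * bⱼ) - p * a * bᵢ - v * bK)
      unfold = solve-∀
      fold : ∀ p bᵢ bⱼ a e → p * (bᵢ * bⱼ) - p * a * bᵢ - p * e ≡ p * (bᵢ * bⱼ - a * bᵢ - e)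
      fold = solve-∀

  record Admissible (B C : Vec ℕ N) : Set where
    field
      canonicalB : CanonicalB B
      canonicalC : CanonicalC C
      B<p : ∀ j → lookup B j ℕ.< p
      C<p : ∀ j → lookup C j ℕ.< p
      condition : Entries.ProductCondition B C canonicalB canonicalC

  IsIrr : Matrix N → Set
  IsIrr = IsIrrSubringMatrix p m (alpha m (suc K) β)

  inject₁≢m : ∀ (i : Fin m) → toℕ (F.inject₁ i) ≢ m
  inject₁≢m i i≡m = ℕP.<⇒≢ (subst (ℕ._< m) (sym (FinP.toℕ-inject₁ i)) (FinP.toℕ<n i)) i≡m

  admissible⇒irreducible : ∀ {B C} → Admissible B C → IsIrr (matrix B C)
  admissible⇒irreducible {B} {C} adm = record
    { upperTriangular = λ i j j<i → trans (entry-matrix B C i j) (entryOf-lower i j j<i)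
    ; diagonal = diagonal
    ; lastDiagonal = trans (entry-matrix B C ilast ilast) (entryOf-last ilast ilast toℕ-ilast)
    ; lastColumn = λ i → trans (entry-matrix B C i ilast) (entryOf-last i ilast toℕ-ilast)
    ; offDiagonal = offDiagonal
    ; closed = closed-if-condition condition
    }
    where
    open Admissible adm
    open Entries B C canonicalB canonicalC
    diagonal : ∀ (i : Fin m) → entry (matrix B C) (F.inject₁ i) (F.inject₁ i) ≡ + (p ℕ.^ lookup (alpha m (suc K) β) i)
    diagonal i = trans (entry-matrix B C _ _) (trans (entryOf-diagonal (F.inject₁ i) (inject₁≢m i))
      (trans (sym (ℤP.pos-* p (bound (F.inject₁ i)))) (cong +_ (trans (p*bound (F.inject₁ i))
        (trans (cong (λ t → p ℕ.^ α t) (FinP.toℕ-inject₁ i)) (cong (p ℕ.^_) (sym (lookup-alpha i))))))))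
    offDiagonal : ∀ (i j : Fin m) → toℕ i ℕ.< toℕ j →
      ∃ λ (a : ℕ) → (a ℕ.< p ℕ.^ (lookup (alpha m (suc K) β) i ℕ.∸ 1)) ×
                     (entry (matrix B C) (F.inject₁ i) (F.inject₁ j) ≡ + (p ℕ.* a))
    offDiagonal i j i<j = coeff B C i′ j′ , coeff<bound ,
      trans (entry-matrix B C i′ j′) (trans (entryOf-coeff i′ j′ (inject₁≢m j)) (sym (ℤP.pos-* p (coeff B C i′ j′))))
      where
      i′ = F.inject₁ i
      j′ = F.inject₁ j
      i′<j′ : toℕ i′ ℕ.< toℕ j′
      i′<j′ = subst₂ ℕ._<_ (sym (FinP.toℕ-inject₁ i)) (sym (FinP.toℕ-inject₁ j)) i<j
      i′≢j′ : toℕ i′ ≢ toℕ j′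
      i′≢j′ = ℕP.<⇒≢ i′<j′
      bound≡ : bound i′ ≡ p ℕ.^ (lookup (alpha m (suc K) β) i ℕ.∸ 1)
      bound≡ = cong (λ a → p ℕ.^ (a ℕ.∸ 1)) (trans (cong α (FinP.toℕ-inject₁ i)) (sym (lookup-alpha i)))
      below-p : ∀ {a} → α (toℕ i′) ≡ 2 → a ℕ.< p → a ℕ.< bound i′
      below-p {a} α≡2 a<p = subst (a ℕ.<_) (sym (bound≡p i′ α≡2)) a<p
      by-row : Dec (toℕ i′ ≡ 0) → Dec (toℕ i′ ≡ K) → coeff B C i′ j′ ℕ.< bound i′
      by-row (yes i≡0) _ = below-p (cong α i≡0)
        (subst (ℕ._< p) (sym (coeff-row0 i′ j′ i≡0 λ j≡0 → ℕP.n≮0 (subst (toℕ i′ ℕ.<_) j≡0 i′<j′))) (B<p j′))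
      by-row (no _) (yes i≡K) = below-p (trans (cong α i≡K) α-K)
        (subst (ℕ._< p) (sym (coeff-rowK i′ j′ i≡K λ j≡K → i′≢j′ (trans i≡K (sym j≡K)))) (C<p j′))
      by-row (no i≢0) (no i≢K) = subst (ℕ._< bound i′) (sym (coeff-otherRow i′ j′ i′≢j′ i≢0 i≢K)) (bound>0 i′)
      coeff<bound : coeff B C i′ j′ ℕ.< p ℕ.^ (lookup (alpha m (suc K) β) i ℕ.∸ 1)
      coeff<bound = subst (coeff B C i′ j′ ℕ.<_) bound≡ (by-row (toℕ i′ ℕ.≟ 0) (toℕ i′ ℕ.≟ K))

  matrix-injective : ∀ {B C B′ C′} → Admissible B C → Admissible B′ C′ →
                     matrix B C ≡ matrix B′ C′ → (B , C) ≡ (B′ , C′)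
  matrix-injective {B} {C} {B′} {C′} adm adm′ M≡M′ = cong₂ _,_ (vec-ext B≗B′) (vec-ext C≗C′)
    where
    module A = Admissible adm
    module A′ = Admissible adm′
    module E = Entries B C A.canonicalB A.canonicalC
    module E′ = Entries B′ C′ A′.canonicalB A′.canonicalC
    entries≡ : ∀ r j → entryOf B C r j ≡ entryOf B′ C′ r j
    entries≡ r j = trans (sym (entry-matrix B C r j)) (trans (cong (λ M → entry M r j) M≡M′) (entry-matrix B′ C′ r j))
    cancel : ∀ {u v} → + p * + u ≡ + p * + v → u ≡ v
    cancel {u} {v} pu≡pv = ℤP.+-injective (ℤP.*-cancelˡ-≡ (+ p) (+ u) (+ v) pu≡pv)
    B≗B′ : ∀ j → lookup B j ≡ lookup B′ j
    B≗B′ j with toℕ j ℕ.≟ 0 | toℕ j ℕ.≟ m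
    ... | yes j≡0 | _ = trans (A.canonicalB j (inj₁ j≡0)) (sym (A′.canonicalB j (inj₁ j≡0)))
    ... | no _ | yes j≡m = trans (A.canonicalB j (inj₂ j≡m)) (sym (A′.canonicalB j (inj₂ j≡m)))
    ... | no j≢0 | no j≢m =
      cancel (trans (sym (E.entryOf-row0 j j≢0 j≢m)) (trans (entries≡ i0 j) (E′.entryOf-row0 j j≢0 j≢m)))
    C≗C′ : ∀ j → lookup C j ≡ lookup C′ j
    C≗C′ j with toℕ j ℕ.≤? K | toℕ j ℕ.≟ m
    ... | yes j≤K | _ = trans (A.canonicalC j (inj₁ j≤K)) (sym (A′.canonicalC j (inj₁ j≤K)))
    ... | no _ | yes j≡m = trans (A.canonicalC j (inj₂ j≡m)) (sym (A′.canonicalC j (inj₂ j≡m)))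
    ... | no j≰K | no j≢m =
      cancel (trans (sym (E.entryOf-rowK j j≢K j≢m)) (trans (entries≡ iK j) (E′.entryOf-rowK j j≢K j≢m)))
      where
      j≢K : toℕ j ≢ K
      j≢K j≡K = j≰K (ℕP.≤-reflexive j≡K)

  module FromMatrix (A : Matrix N) (irr : IsIrr A) where
    open IsIrrSubringMatrix irr

    shrink : ∀ (x : Fin N) → toℕ x ℕ.< m → Fin m
    shrink x x<m = F.fromℕ< x<m

    toℕ-shrink : ∀ x x<m → toℕ (shrink x x<m) ≡ toℕ x
    toℕ-shrink x x<m = FinP.toℕ-fromℕ< x<m

    inject₁-shrink : ∀ x x<m → F.inject₁ (shrink x x<m) ≡ x
    inject₁-shrink x x<m = FinP.toℕ-injective (trans (FinP.toℕ-inject₁ (shrink x x<m)) (toℕ-shrink x x<m))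

    aOf : (i j : Fin N) → Dec (toℕ i ℕ.< toℕ j) → Dec (toℕ j ℕ.< m) → ℕ
    aOf i j (yes i<j) (yes j<m) = proj₁ (offDiagonal (shrink i i<m) (shrink j j<m)
      (subst₂ ℕ._<_ (sym (toℕ-shrink i i<m)) (sym (toℕ-shrink j j<m)) i<j))
      where
      i<m = ℕP.<-trans i<j j<m
    aOf i j _ _ = 0

    a : Fin N → Fin N → ℕ
    a i j = aOf i j (toℕ i ℕ.<? toℕ j) (toℕ j ℕ.<? m)

    aOf-spec : ∀ i j d₁ d₂ → toℕ i ℕ.< toℕ j → toℕ j ℕ.< m →
               (entry A i j ≡ + (p ℕ.* aOf i j d₁ d₂)) × (aOf i j d₁ d₂ ℕ.< bound i)
    aOf-spec i j (yes i<j) (yes j<m) _ _ =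
      subst₂ (λ u v → entry A u v ≡ + (p ℕ.* proj₁ od)) (inject₁-shrink i i<m) (inject₁-shrink j j<m) (proj₂ (proj₂ od)) ,
      subst (λ t → proj₁ od ℕ.< p ℕ.^ (t ℕ.∸ 1)) (trans (lookup-alpha i′) (cong α (toℕ-shrink i i<m))) (proj₁ (proj₂ od))
      where
      i<m = ℕP.<-trans i<j j<m
      i′ = shrink i i<m
      od = offDiagonal i′ (shrink j j<m) (subst₂ ℕ._<_ (sym (toℕ-shrink i i<m)) (sym (toℕ-shrink j j<m)) i<j)
    aOf-spec i j (no i≮j) _ i<j _ = ⊥-elim (i≮j i<j)
    aOf-spec i j (yes _) (no j≮m) _ j<m = ⊥-elim (j≮m j<m)

    a-spec : ∀ i j → toℕ i ℕ.< toℕ j → toℕ j ℕ.< m → (entry A i j ≡ + (p ℕ.* a i j)) × (a i j ℕ.< bound i)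
    a-spec i j = aOf-spec i j (toℕ i ℕ.<? toℕ j) (toℕ j ℕ.<? m)

    aOf-outside : ∀ i j d₁ d₂ → ¬ (toℕ i ℕ.< toℕ j × toℕ j ℕ.< m) → aOf i j d₁ d₂ ≡ 0
    aOf-outside i j (yes i<j) (yes j<m) outside = ⊥-elim (outside (i<j , j<m))
    aOf-outside i j (yes _) (no _) _ = refl
    aOf-outside i j (no _) _ _ = refl

    a-outside : ∀ i j → ¬ (toℕ i ℕ.< toℕ j × toℕ j ℕ.< m) → a i j ≡ 0
    a-outside i j = aOf-outside i j (toℕ i ℕ.<? toℕ j) (toℕ j ℕ.<? m)

    aOf<p : ∀ i j d₁ d₂ → α (toℕ i) ≡ 2 → aOf i j d₁ d₂ ℕ.< p
    aOf<p i j d₁@(yes i<j) d₂@(yes j<m) α≡2 =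
      subst (aOf i j d₁ d₂ ℕ.<_) (bound≡p i α≡2) (proj₂ (aOf-spec i j d₁ d₂ i<j j<m))
    aOf<p i j (yes _) (no _) _ = ℕ.s≤s ℕ.z≤n
    aOf<p i j (no _) _ _ = ℕ.s≤s ℕ.z≤n

    a<p : ∀ i j → α (toℕ i) ≡ 2 → a i j ℕ.< p
    a<p i j = aOf<p i j (toℕ i ℕ.<? toℕ j) (toℕ j ℕ.<? m)

    B C : Vec ℕ N
    B = tabulate (a i0)
    C = tabulate (a iK)

    canonicalB : CanonicalB B
    canonicalB j (inj₁ j≡0) = trans (VecP.lookup∘tabulate (a i0) j) (a-outside i0 j λ (0<j , _) → ℕP.<⇒≢ 0<j (sym j≡0))
    canonicalB j (inj₂ j≡m) = trans (VecP.lookup∘tabulate (a i0) j) (a-outside i0 j λ (_ , j<m) → ℕP.<⇒≢ j<m j≡m)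

    canonicalC : CanonicalC C
    canonicalC j (inj₁ j≤K) = trans (VecP.lookup∘tabulate (a iK) j)
      (a-outside iK j λ (K<j , _) → ℕP.<⇒≱ K<j (subst (toℕ j ℕ.≤_) (sym toℕ-iK) j≤K))
    canonicalC j (inj₂ j≡m) = trans (VecP.lookup∘tabulate (a iK) j) (a-outside iK j λ (_ , j<m) → ℕP.<⇒≢ j<m j≡m)

    open Entries B C canonicalB canonicalC using (coeff-row0; coeff-rowK; coeff-otherRow; coeff-diagonal;
      entryOf-last; entryOf-coeff; entryOf-lower; condition-if-closed; M)

    coeff≡a : ∀ r j → toℕ r ℕ.< toℕ j → toℕ j ℕ.< m → coeff B C r j ≡ a r j
    coeff≡a r j r<j j<m with toℕ r ℕ.≟ 0 | toℕ r ℕ.≟ K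
    ... | yes r≡0 | _ = trans (coeff-row0 r j r≡0 λ j≡0 → ℕP.n≮0 (subst (toℕ r ℕ.<_) j≡0 r<j))
                       (trans (VecP.lookup∘tabulate (a i0) j) (cong (λ u → a u j) (sym (FinP.toℕ-injective {i = r} {j = i0} r≡0))))
    ... | no _ | yes r≡K = trans (coeff-rowK r j r≡K λ j≡K → ℕP.<⇒≢ r<j (trans r≡K (sym j≡K)))
                       (trans (VecP.lookup∘tabulate (a iK) j) (cong (λ u → a u j) (sym (FinP.toℕ-injective (trans r≡K (sym toℕ-iK))))))
    ... | no r≢0 | no r≢K = trans (coeff-otherRow r j (ℕP.<⇒≢ r<j) r≢0 r≢K) (sym (ℕP.n<1⇒n≡0 a<1))
      where
      r≢m∸1 : toℕ r ≢ m ℕ.∸ 1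
      r≢m∸1 = ℕP.<⇒≢ (ℕP.<-≤-trans r<j (ℕP.∸-monoˡ-≤ 1 j<m))
      a<1 : a r j ℕ.< 1
      a<1 = subst (λ t → a r j ℕ.< p ℕ.^ (t ℕ.∸ 1)) (α-other (toℕ r) r≢0 r≢K r≢m∸1) (proj₂ (a-spec r j r<j j<m))

    entry≡entryOf-diagonal : ∀ j → toℕ j ℕ.< m → entry A j j ≡ entryOf B C j j
    entry≡entryOf-diagonal j j<m = begin
        entry A j j
      ≡⟨ cong (λ u → entry A u u) (sym (inject₁-shrink j j<m)) ⟩
        entry A (F.inject₁ j′) (F.inject₁ j′)
      ≡⟨ diagonal j′ ⟩
        + (p ℕ.^ lookup (alpha m (suc K) β) j′)
      ≡⟨ cong (λ t → + (p ℕ.^ t)) (trans (lookup-alpha j′) (cong α (toℕ-shrink j j<m))) ⟩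
        + (p ℕ.^ α (toℕ j))
      ≡⟨ trans (cong +_ (sym (p*bound j))) (ℤP.pos-* p (bound j)) ⟩
        + p * + bound j
      ≡⟨ cong (λ t → + p * + t) (sym (coeff-diagonal j j refl)) ⟩
        + p * + coeff B C j j
      ≡⟨ sym (entryOf-coeff j j (ℕP.<⇒≢ j<m)) ⟩
        entryOf B C j j ∎
      where
      open ≡-Reasoning
      j′ = shrink j j<m

    entry≡entryOf : ∀ r j → entry A r j ≡ entryOf B C r j
    entry≡entryOf r j = by-last (toℕ j ℕ.≟ m)
      where
      by-last : Dec (toℕ j ≡ m) → entry A r j ≡ entryOf B C r j
      by-last (yes j≡m) = trans (cong (entry A r) (FinP.toℕ-injective (trans j≡m (sym toℕ-ilast))))
                                (trans (lastColumn r) (sym (entryOf-last r j j≡m)))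
      by-last (no j≢m) with ℕP.<-cmp (toℕ r) (toℕ j)
      ... | tri> _ _ j<r = trans (upperTriangular r j j<r) (sym (entryOf-lower r j j<r))
      ... | tri< r<j _ _ = trans (proj₁ (a-spec r j r<j j<m))
                                 (trans (trans (ℤP.pos-* p (a r j)) (cong (λ t → + p * + t) (sym (coeff≡a r j r<j j<m))))
                                        (sym (entryOf-coeff r j j≢m)))
        where
        j<m : toℕ j ℕ.< m
        j<m = ℕP.≤∧≢⇒< (toℕ≤m j) j≢m
      ... | tri≈ _ r≡j _ rewrite FinP.toℕ-injective r≡j = entry≡entryOf-diagonal j (ℕP.≤∧≢⇒< (toℕ≤m j) j≢m)

    A≡matrix : A ≡ matrix B C
    A≡matrix = vec-ext λ r → vec-ext λ j → trans (entry≡entryOf r j) (sym (entry-matrix B C r j))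

    admissible : Admissible B C
    admissible = record
      { canonicalB = canonicalB
      ; canonicalC = canonicalC
      ; B<p = λ j → subst (ℕ._< p) (sym (VecP.lookup∘tabulate (a i0) j)) (a<p i0 j α-zero)
      ; C<p = λ j → subst (ℕ._< p) (sym (VecP.lookup∘tabulate (a iK) j)) (a<p iK j (trans (cong α toℕ-iK) α-K))
      ; condition = condition-if-closed (subst SubringClosed A≡matrix closed)
      }

module Count (p′ m K β : ℕ) (p-prime : Prime (suc (suc p′))) (K≢0 : K ≢ 0) (2+K≤m : 2 ℕ.+ K ℕ.≤ m) (1<β : 1 ℕ.< β) where

  open import Data.Nat.Divisibility using (_∣_; divides; >⇒∤; ∣m+n∣m⇒∣n)
  open import Data.Nat.Primality using (euclidsLemma)
  open import Data.Integer using (+_; _*_; _-_; ∣_∣; _⊖_)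
  open import Algebra.Properties.Semiring.Sum ℕP.+-*-semiring using (sum; ∑-distrib-+)
  open import Algebra.Properties.CommutativeMonoid.Sum ℕP.*-1-commutativeMonoid
    using () renaming (sum to product; sum-cong-≗ to product-cong-≗; ∑-distrib-+ to product-distrib-*)
  open import Function.Bundles using (mk⇔)
  open import Data.List using (applyUpTo; upTo; cartesianProduct; _++_)
  open ColumnSpan using (vec-ext)
  open Enumeration
  open Shape p′ m K β K≢0 2+K≤m 1<β

  0<p : 0 ℕ.< p
  0<p = ℕ.s≤s ℕ.z≤n

  ∣∧<⇒≡0 : ∀ {x} → p ∣ x → x ℕ.< p → x ≡ 0
  ∣∧<⇒≡0 {zero} _ _ = refl
  ∣∧<⇒≡0 {suc x} p∣x x<p = ⊥-elim (>⇒∤ x<p p∣x)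

  R : ℕ
  R = m ℕ.∸ suc (suc K)

  -- Positions K < a < m − 1: those where a unit c_a is allowed when b_K ≠ 0.
  positions : List ℕ
  positions = applyUpTo (suc K ℕ.+_) R

  K+1+R≡m∸1 : suc K ℕ.+ R ≡ m ℕ.∸ 1
  K+1+R≡m∸1 = cong (ℕ._∸ 1) (ℕP.m+[n∸m]≡n {suc (suc K)} {m} 2+K≤m)

  ∈-positions⁻ : ∀ {a} → a ∈ positions → K ℕ.< a × a ℕ.< m ℕ.∸ 1
  ∈-positions⁻ a∈ with ∈P.∈-applyUpTo⁻ (suc K ℕ.+_) a∈
  ... | t , t<R , refl = ℕ.s≤s (ℕP.m≤m+n K t) ,
    ℕP.≤-trans (ℕP.≤-reflexive (sym (ℕP.+-suc (suc K) t))) (ℕP.≤-trans (ℕP.+-monoʳ-≤ (suc K) t<R) (ℕP.≤-reflexive K+1+R≡m∸1))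

  ∈-positions⁺ : ∀ {a} → K ℕ.< a → a ℕ.< m ℕ.∸ 1 → a ∈ positions
  ∈-positions⁺ {a} K<a a<m∸1 = subst (_∈ positions) a≡ (∈P.∈-applyUpTo⁺ (suc K ℕ.+_)
    (ℕP.+-cancelˡ-< (suc K) (a ℕ.∸ suc K) R (subst₂ ℕ._<_ (sym a≡) (sym K+1+R≡m∸1) a<m∸1)))
    where
    a≡ : suc K ℕ.+ (a ℕ.∸ suc K) ≡ a
    a≡ = ℕP.m+[n∸m]≡n K<a

  oneHot : ℕ → Vec ℕ N
  oneHot a = tabulate λ s → 𝟙 (toℕ s ℕ.≟ a)

  zeros : Vec ℕ N
  zeros = tabulate λ _ → 0

  lookup-zeros : ∀ j → lookup zeros j ≡ 0
  lookup-zeros = VecP.lookup∘tabulate (λ _ → 0)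

  lookup-oneHot : ∀ a j → lookup (oneHot a) j ≡ 𝟙 (toℕ j ℕ.≟ a)
  lookup-oneHot a = VecP.lookup∘tabulate (λ s → 𝟙 (toℕ s ℕ.≟ a))

  oneHot-≢ : ∀ a j → toℕ j ≢ a → lookup (oneHot a) j ≡ 0
  oneHot-≢ a j j≢a = trans (lookup-oneHot a j) (𝟙-no (toℕ j ℕ.≟ a) j≢a)

  oneHot-≡ : ∀ a j → toℕ j ≡ a → lookup (oneHot a) j ≡ 1
  oneHot-≡ a j j≡a = trans (lookup-oneHot a j) (𝟙-yes (toℕ j ℕ.≟ a) j≡a)

  -- The possible rows C when b_K ≠ 0.
  unitRows : List (Vec ℕ N)
  unitRows = zeros List.∷ List.map oneHot positions

  classify : ∀ s → (toℕ s ℕ.≤ K ⊎ toℕ s ≡ m) ⊎ Ordinary s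
  classify s with toℕ s ℕ.≤? K | toℕ s ℕ.≟ m
  ... | yes s≤K | _ = inj₁ (inj₁ s≤K)
  ... | no _ | yes s≡m = inj₁ (inj₂ s≡m)
  ... | no s≰K | no s≢m =
    inj₂ ((λ s≡0 → s≰K (subst (ℕ._≤ K) (sym s≡0) ℕ.z≤n)) , (λ s≡K → s≰K (ℕP.≤-reflexive s≡K)) , s≢m)

  -- When p ∤ b_K, the product condition says p ∣ y i j for all ordinary i, j, i.e.
  -- p ∣ c_i c_j (i ≠ j) and p ∣ c_i (c_i − p^(α_i − 1)); with 0 ≤ c < p this leaves
  -- at most one nonzero c_i, equal to 1, and not at the position m − 1 where α = β > 1.
  module UnitRow {B C} (adm : Admissible B C) (bK≢0 : lookup B iK ≢ 0) where
    open Admissible adm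
    open Entries B C canonicalB canonicalC

    p∣y : ∀ i j → Ordinary i → Ordinary j → p ∣ ∣ y i j ∣
    p∣y i j oi oj with condition i j oi oj
    ... | q , bK*y≡p*q with euclidsLemma (lookup B iK) ∣ y i j ∣ p-prime
          (divides ∣ q ∣ (trans (trans (sym (ℤP.abs-* (b iK) (y i j))) (trans (cong ∣_∣ bK*y≡p*q) (ℤP.abs-* P q)))
                                (ℕP.*-comm p ∣ q ∣)))
    ...   | inj₁ p∣bK = ⊥-elim (bK≢0 (∣∧<⇒≡0 p∣bK (B<p iK)))
    ...   | inj₂ p∣y = p∣y

    offDiagonal-zero : ∀ i j → Ordinary i → Ordinary j → toℕ i ≢ toℕ j → lookup C i ≡ 0 ⊎ lookup C j ≡ 0
    offDiagonal-zero i j oi oj i≢j with euclidsLemma (lookup C i) (lookup C j) p-prime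
      (subst (p ∣_) (trans (cong ∣_∣ (y-offDiagonal i j i≢j)) (ℤP.abs-* (c i) (c j))) (p∣y i j oi oj))
    ... | inj₁ p∣cᵢ = inj₁ (∣∧<⇒≡0 p∣cᵢ (C<p i))
    ... | inj₂ p∣cⱼ = inj₂ (∣∧<⇒≡0 p∣cⱼ (C<p j))

    diagonal-zeroOr : ∀ i → Ordinary i → lookup C i ≡ 0 ⊎ p ∣ ∣ lookup C i ⊖ bound i ∣
    diagonal-zeroOr i oi with euclidsLemma (lookup C i) ∣ lookup C i ⊖ bound i ∣ p-prime
      (subst (p ∣_) (trans (cong ∣_∣ (trans (y-diagonal i) (trans (factor (c i) (+ bound i))
                                 (cong (c i *_) (ℤP.m-n≡m⊖n (lookup C i) (bound i))))))
                           (ℤP.abs-* (c i) _))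
                    (p∣y i i oi oi))
      where
      factor : ∀ u v → u * u - u * v ≡ u * (u - v)
      factor = solve-∀
    ... | inj₁ p∣cᵢ = inj₁ (∣∧<⇒≡0 p∣cᵢ (C<p i))
    ... | inj₂ p∣cᵢ-bound = inj₂ p∣cᵢ-bound

    c≤1 : ∀ i → Ordinary i → toℕ i ≢ m ℕ.∸ 1 → lookup C i ℕ.≤ 1
    c≤1 i oi@(i≢0 , i≢K , _) i≢m∸1 with diagonal-zeroOr i oi | lookup C i in cᵢ≡ | C<p i
    ... | inj₁ _ | zero | _ = ℕ.z≤n
    ... | inj₂ _ | zero | _ = ℕ.z≤n
    ... | _ | suc zero | _ = ℕ.s≤s ℕ.z≤n
    ... | inj₁ cᵢ≡0 | suc (suc _) | _ = ⊥-elim (ℕP.1+n≢0 (trans (sym cᵢ≡) cᵢ≡0))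
    ... | inj₂ p∣cᵢ-1 | suc (suc c′) | cᵢ<p =
      ⊥-elim (ℕP.1+n≢0 (∣∧<⇒≡0 p∣c′+1 (ℕP.<-trans (ℕP.n<1+n (suc c′)) cᵢ<p)))
      where
      bound≡1 : bound i ≡ 1
      bound≡1 = cong (λ a → p ℕ.^ (a ℕ.∸ 1)) (α-other (toℕ i) i≢0 i≢K i≢m∸1)
      p∣c′+1 : p ∣ suc c′
      p∣c′+1 = subst (λ z → p ∣ ∣ z ∣) (trans (cong₂ _⊖_ cᵢ≡ bound≡1) (ℤP.⊖-≥ (ℕ.s≤s ℕ.z≤n))) p∣cᵢ-1

    c-m∸1≡0 : ∀ i → Ordinary i → toℕ i ≡ m ℕ.∸ 1 → lookup C i ≡ 0
    c-m∸1≡0 i oi i≡m∸1 with diagonal-zeroOr i oi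
    ... | inj₁ cᵢ≡0 = cᵢ≡0
    ... | inj₂ p∣cᵢ-bound = ∣∧<⇒≡0 (∣m+n∣m⇒∣n (subst (p ∣_) (sym (ℕP.m∸n+n≡m cᵢ≤bound)) p∣bound)
                                             (subst (p ∣_) (ℤP.∣⊖∣-≤ cᵢ≤bound) p∣cᵢ-bound))
                                  (C<p i)
      where
      β′ = β ℕ.∸ 1 ℕ.∸ 1
      bound≡ : bound i ≡ p ℕ.* p ℕ.^ β′
      bound≡ = trans (cong (λ a → p ℕ.^ (a ℕ.∸ 1)) (trans (cong α i≡m∸1) α-m∸1))
                     (cong (p ℕ.^_) (sym (ℕP.m+[n∸m]≡n {1} {β ℕ.∸ 1} (ℕP.∸-monoˡ-≤ 1 1<β))))
      p∣bound : p ∣ bound i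
      p∣bound = divides (p ℕ.^ β′) (trans bound≡ (ℕP.*-comm p (p ℕ.^ β′)))
      cᵢ≤bound : lookup C i ℕ.≤ bound i
      cᵢ≤bound = ℕP.<⇒≤ (ℕP.<-≤-trans (C<p i)
                   (subst (p ℕ.≤_) (sym bound≡) (ℕP.m≤m*n p (p ℕ.^ β′) {{ℕP.m^n≢0 p β′}})))

    c≡0-unless-1 : ∀ s → lookup C s ≢ 1 → lookup C s ≡ 0
    c≡0-unless-1 s cₛ≢1 with classify s
    ... | inj₁ vanishing = canonicalC s vanishing
    ... | inj₂ os with toℕ s ℕ.≟ m ℕ.∸ 1
    ...   | yes s≡m∸1 = c-m∸1≡0 s os s≡m∸1
    ...   | no s≢m∸1 with lookup C s | c≤1 s os s≢m∸1
    ...     | zero | _ = refl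
    ...     | suc zero | _ = ⊥-elim (cₛ≢1 refl)
    ...     | suc (suc _) | ℕ.s≤s ()

    unit-position : ∀ a → lookup C a ≡ 1 → Ordinary a × K ℕ.< toℕ a × toℕ a ℕ.< m ℕ.∸ 1
    unit-position a cₐ≡1 with classify a
    ... | inj₁ vanishing = ⊥-elim (ℕP.1+n≢0 (trans (sym cₐ≡1) (canonicalC a vanishing)))
    ... | inj₂ oa@(_ , _ , a≢m) = oa , K<a , a<m∸1
      where
      K<a : K ℕ.< toℕ a
      K<a = ℕP.≰⇒> λ a≤K → ℕP.1+n≢0 (trans (sym cₐ≡1) (canonicalC a (inj₁ a≤K)))
      a<m∸1 : toℕ a ℕ.< m ℕ.∸ 1
      a<m∸1 = ℕP.≤∧≢⇒< (ℕP.∸-monoˡ-≤ 1 (ℕP.≤∧≢⇒< (toℕ≤m a) a≢m))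
                       λ a≡m∸1 → ℕP.1+n≢0 (trans (sym cₐ≡1) (c-m∸1≡0 a oa a≡m∸1))

    C∈unitRows : C ∈ unitRows
    C∈unitRows with FinP.any? (λ a → lookup C a ℕ.≟ 1)
    ... | no no-unit = here (vec-ext λ s → trans (c≡0-unless-1 s λ cₛ≡1 → no-unit (s , cₛ≡1)) (sym (lookup-zeros s)))
    ... | yes (a , cₐ≡1) with unit-position a cₐ≡1
    ...   | oa , K<a , a<m∸1 = there (subst (_∈ List.map oneHot positions) (sym C≡oneHot)
                                            (∈P.∈-map⁺ oneHot (∈-positions⁺ K<a a<m∸1)))
      where
      C≡oneHot : C ≡ oneHot (toℕ a)
      C≡oneHot = vec-ext pointwise
        where
        pointwise : ∀ s → lookup C s ≡ lookup (oneHot (toℕ a)) s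
        pointwise s with toℕ s ℕ.≟ toℕ a
        ... | yes s≡a = trans (cong (lookup C) (FinP.toℕ-injective s≡a)) (trans cₐ≡1 (sym (oneHot-≡ (toℕ a) s s≡a)))
        ... | no s≢a = trans cₛ≡0 (sym (oneHot-≢ (toℕ a) s s≢a))
          where
          cₛ≡0 : lookup C s ≡ 0
          cₛ≡0 with classify s
          ... | inj₁ vanishing = canonicalC s vanishing
          ... | inj₂ os with offDiagonal-zero s a os oa s≢a
          ...   | inj₁ cₛ≡0 = cₛ≡0
          ...   | inj₂ cₐ≡0 = ⊥-elim (ℕP.1+n≢0 (trans (sym cₐ≡1) cₐ≡0))

  module _ (B C : Vec ℕ N) (canB : CanonicalB B) (canC : CanonicalC C)
           (unit : ∀ i → Ordinary i → lookup C i ≡ 0 ⊎ (lookup C i ≡ 1 × toℕ i ≢ m ℕ.∸ 1))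
           (single : ∀ i j → toℕ i ≢ toℕ j → lookup C i ≡ 0 ⊎ lookup C j ≡ 0) where
    open Entries B C canB canC

    y≡0 : ∀ i j → Ordinary i → Ordinary j → y i j ≡ + 0
    y≡0 i j oi@(i≢0 , i≢K , _) _ = by-cases (toℕ i ℕ.≟ toℕ j)
      where
      diagonal : lookup C i ≡ 0 ⊎ (lookup C i ≡ 1 × toℕ i ≢ m ℕ.∸ 1) → c i * c i - c i * + bound i ≡ + 0
      diagonal (inj₁ cᵢ≡0) rewrite cᵢ≡0 = refl
      diagonal (inj₂ (cᵢ≡1 , i≢m∸1)) rewrite cᵢ≡1 | α-other (toℕ i) i≢0 i≢K i≢m∸1 = refl
      offDiagonal : lookup C i ≡ 0 ⊎ lookup C j ≡ 0 → c i * c j ≡ + 0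
      offDiagonal (inj₁ cᵢ≡0) rewrite cᵢ≡0 = refl
      offDiagonal (inj₂ cⱼ≡0) rewrite cⱼ≡0 = ℤP.*-zeroʳ (c i)
      by-cases : Dec (toℕ i ≡ toℕ j) → y i j ≡ + 0
      by-cases (yes i≡j) with refl ← FinP.toℕ-injective i≡j = trans (y-diagonal i) (diagonal (unit i oi))
      by-cases (no i≢j) = trans (y-offDiagonal i j i≢j) (offDiagonal (single i j i≢j))

    condition-if-y≡0 : ProductCondition
    condition-if-y≡0 i j oi oj = + 0 , trans (cong (b iK *_) (y≡0 i j oi oj)) (trans (ℤP.*-zeroʳ (b iK)) (sym (ℤP.*-zeroʳ P)))

  units : List ℕ
  units = applyUpTo suc (p ℕ.∸ 1)

  [0] : List ℕ
  [0] = 0 List.∷ List.[]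

  ∈[0]⁻ : ∀ {x} → x ∈ [0] → x ≡ 0
  ∈[0]⁻ (here x≡0) = x≡0

  [0]⁺ : Unique [0]
  [0]⁺ = All.[] AllPairs.∷ AllPairs.[]

  ∈-units⁻ : ∀ {x} → x ∈ units → 0 ℕ.< x × x ℕ.< p
  ∈-units⁻ x∈ with ∈P.∈-applyUpTo⁻ suc x∈
  ... | t , t<p-1 , refl = ℕ.s≤s ℕ.z≤n , ℕP.≤-trans (ℕ.s≤s t<p-1) (ℕP.≤-reflexive (ℕP.m+[n∸m]≡n {1} {p} 0<p))

  ∈-units⁺ : ∀ {x} → 0 ℕ.< x → x ℕ.< p → x ∈ units
  ∈-units⁺ {suc t} _ x<p = ∈P.∈-applyUpTo⁺ suc (ℕP.∸-monoˡ-≤ 1 x<p)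

  units⁺ : Unique units
  units⁺ = UniqueP.applyUpTo⁺₁ suc (p ℕ.∸ 1) λ i<j _ → ℕP.<⇒≢ i<j ∘ ℕP.suc-injective

  length-units : length units ≡ p ℕ.∸ 1
  length-units = ListP.length-applyUpTo suc (p ℕ.∸ 1)

  length-upTo-p : length (upTo p) ≡ p ℕ.^ 1
  length-upTo-p = trans (ListP.length-upTo p) (sym (ℕP.*-identityʳ p))

  module _ {Q₀ Q_K Qₘ : Set} where

    bFree : Dec Q₀ → Dec Q_K → Dec Qₘ → ℕ
    bFree (no _) (no _) (no _) = 1
    bFree _ _ _ = 0

    bFree-partition : ∀ d₀ d_K dₘ → (Q₀ → ¬ Q_K) → (Q₀ → ¬ Qₘ) → (Q_K → ¬ Qₘ) →
                      bFree d₀ d_K dₘ ℕ.+ (𝟙 d₀ ℕ.+ 𝟙 d_K ℕ.+ 𝟙 dₘ) ≡ 1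
    bFree-partition (yes q₀) (yes q_K) _ 0≢K _ _ = ⊥-elim (0≢K q₀ q_K)
    bFree-partition (yes q₀) (no _) (yes qₘ) _ 0≢m _ = ⊥-elim (0≢m q₀ qₘ)
    bFree-partition (yes _) (no _) (no _) _ _ _ = refl
    bFree-partition (no _) (yes q_K) (yes qₘ) _ _ K≢m = ⊥-elim (K≢m q_K qₘ)
    bFree-partition (no _) (yes _) (no _) _ _ _ = refl
    bFree-partition (no _) (no _) (yes _) _ _ _ = refl
    bFree-partition (no _) (no _) (no _) _ _ _ = refl

  module _ {Q₀ Q_K Qₘ : Set} (kv : List ℕ) where

    bValues : Dec Q₀ → Dec Q_K → Dec Qₘ → List ℕ
    bValues (yes _) _ _ = [0]
    bValues (no _) (yes _) _ = kv
    bValues (no _) (no _) (yes _) = [0]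
    bValues (no _) (no _) (no _) = upTo p

    ∈-bValues⁻ : ∀ {x} d₀ d_K dₘ → (Q_K → ¬ Qₘ) → (∀ {z} → z ∈ kv → z ℕ.< p) → x ∈ bValues d₀ d_K dₘ →
                 ((Q₀ ⊎ Qₘ) → x ≡ 0) × (Q_K → ¬ Q₀ → x ∈ kv) × x ℕ.< p
    ∈-bValues⁻ (yes q₀) _ _ _ _ x∈ =
      (λ _ → ∈[0]⁻ x∈) , (λ _ ¬q₀ → ⊥-elim (¬q₀ q₀)) , subst (ℕ._< p) (sym (∈[0]⁻ x∈)) 0<p
    ∈-bValues⁻ (no ¬q₀) (yes q_K) _ K≢m kv<p x∈ =
      (λ { (inj₁ q₀) → ⊥-elim (¬q₀ q₀) ; (inj₂ qₘ) → ⊥-elim (K≢m q_K qₘ) }) , (λ _ _ → x∈) , kv<p x∈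
    ∈-bValues⁻ (no _) (no ¬q_K) (yes _) _ _ x∈ =
      (λ _ → ∈[0]⁻ x∈) , (λ q_K → ⊥-elim (¬q_K q_K)) , subst (ℕ._< p) (sym (∈[0]⁻ x∈)) 0<p
    ∈-bValues⁻ (no ¬q₀) (no ¬q_K) (no ¬qₘ) _ _ x∈ =
      (λ { (inj₁ q₀) → ⊥-elim (¬q₀ q₀) ; (inj₂ qₘ) → ⊥-elim (¬qₘ qₘ) }) , (λ q_K → ⊥-elim (¬q_K q_K)) , ∈P.∈-upTo⁻ x∈

    ∈-bValues⁺ : ∀ {x} d₀ d_K dₘ → ((Q₀ ⊎ Qₘ) → x ≡ 0) → (Q_K → ¬ Q₀ → x ∈ kv) → x ℕ.< p → x ∈ bValues d₀ d_K dₘ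
    ∈-bValues⁺ (yes q₀) _ _ x≡0 _ _ = here (x≡0 (inj₁ q₀))
    ∈-bValues⁺ (no ¬q₀) (yes q_K) _ _ x∈kv _ = x∈kv q_K ¬q₀
    ∈-bValues⁺ (no _) (no _) (yes qₘ) x≡0 _ _ = here (x≡0 (inj₂ qₘ))
    ∈-bValues⁺ (no _) (no _) (no _) _ _ x<p = ∈P.∈-upTo⁺ x<p

    bValues⁺ : Unique kv → ∀ d₀ d_K dₘ → Unique (bValues d₀ d_K dₘ)
    bValues⁺ _ (yes _) _ _ = [0]⁺
    bValues⁺ kv⁺ (no _) (yes _) _ = kv⁺
    bValues⁺ _ (no _) (no _) (yes _) = [0]⁺
    bValues⁺ _ (no _) (no _) (no _) = UniqueP.upTo⁺ p

    length-bValues : ∀ d₀ d_K dₘ → (Q₀ → ¬ Q_K) →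
                     length (bValues d₀ d_K dₘ) ≡ p ℕ.^ bFree d₀ d_K dₘ ℕ.* length kv ℕ.^ 𝟙 d_K
    length-bValues (yes q₀) (yes q_K) _ 0≢K = ⊥-elim (0≢K q₀ q_K)
    length-bValues (yes _) (no _) _ _ = refl
    length-bValues (no _) (yes _) _ _ = sym (trans (ℕP.*-identityˡ _) (ℕP.*-identityʳ _))
    length-bValues (no _) (no _) (yes _) _ = refl
    length-bValues (no _) (no _) (no _) _ = trans length-upTo-p (sym (ℕP.*-identityʳ _))

  module _ {Q_≤ Qₘ : Set} where

    cValues : Dec Q_≤ → Dec Qₘ → List ℕ
    cValues (no _) (no _) = upTo p
    cValues _ _ = [0]

    cFree : Dec Q_≤ → Dec Qₘ → ℕ
    cFree (no _) (no _) = 1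
    cFree _ _ = 0

    ∈-cValues⁻ : ∀ {x} d_≤ dₘ → x ∈ cValues d_≤ dₘ → ((Q_≤ ⊎ Qₘ) → x ≡ 0) × x ℕ.< p
    ∈-cValues⁻ (yes _) _ x∈ = (λ _ → ∈[0]⁻ x∈) , subst (ℕ._< p) (sym (∈[0]⁻ x∈)) 0<p
    ∈-cValues⁻ (no _) (yes _) x∈ = (λ _ → ∈[0]⁻ x∈) , subst (ℕ._< p) (sym (∈[0]⁻ x∈)) 0<p
    ∈-cValues⁻ (no ¬q≤) (no ¬qₘ) x∈ =
      (λ { (inj₁ q≤) → ⊥-elim (¬q≤ q≤) ; (inj₂ qₘ) → ⊥-elim (¬qₘ qₘ) }) , ∈P.∈-upTo⁻ x∈

    ∈-cValues⁺ : ∀ {x} d_≤ dₘ → ((Q_≤ ⊎ Qₘ) → x ≡ 0) → x ℕ.< p → x ∈ cValues d_≤ dₘ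
    ∈-cValues⁺ (yes q≤) _ x≡0 _ = here (x≡0 (inj₁ q≤))
    ∈-cValues⁺ (no _) (yes qₘ) x≡0 _ = here (x≡0 (inj₂ qₘ))
    ∈-cValues⁺ (no _) (no _) _ x<p = ∈P.∈-upTo⁺ x<p

    cValues⁺ : ∀ d_≤ dₘ → Unique (cValues d_≤ dₘ)
    cValues⁺ (yes _) _ = [0]⁺
    cValues⁺ (no _) (yes _) = [0]⁺
    cValues⁺ (no _) (no _) = UniqueP.upTo⁺ p

    length-cValues : ∀ d_≤ dₘ → length (cValues d_≤ dₘ) ≡ p ℕ.^ cFree d_≤ dₘ
    length-cValues (yes _) _ = refl
    length-cValues (no _) (yes _) = refl
    length-cValues (no _) (no _) = length-upTo-p

    cFree-partition : ∀ d_≤ dₘ → (Q_≤ → ¬ Qₘ) → cFree d_≤ dₘ ℕ.+ (𝟙 d_≤ ℕ.+ 𝟙 dₘ) ≡ 1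
    cFree-partition (yes q≤) (yes qₘ) ≤≢m = ⊥-elim (≤≢m q≤ qₘ)
    cFree-partition (yes _) (no _) _ = refl
    cFree-partition (no _) (yes _) _ = refl
    cFree-partition (no _) (no _) _ = refl

  bValuesAt : List ℕ → Fin N → List ℕ
  bValuesAt kv j = bValues kv (toℕ j ℕ.≟ 0) (toℕ j ℕ.≟ K) (toℕ j ℕ.≟ m)

  cValuesAt : Fin N → List ℕ
  cValuesAt j = cValues (toℕ j ℕ.<? suc K) (toℕ j ℕ.≟ m)

  K-not-m : ∀ {x} → x ≡ K → x ≢ m
  K-not-m x≡K x≡m = K≢m (trans (sym x≡K) x≡m)

  0-not-K : ∀ {x} → x ≡ 0 → x ≢ K
  0-not-K x≡0 x≡K = K≢0 (trans (sym x≡K) x≡0)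

  0-not-m : ∀ {x} → x ≡ 0 → x ≢ m
  0-not-m x≡0 x≡m = 0≢m (trans (sym x≡0) x≡m)

  ≤K-not-m : ∀ {x} → x ℕ.< suc K → x ≢ m
  ≤K-not-m x<1+K x≡m = ℕP.<⇒≱ K<m (ℕP.≤-pred (subst (ℕ._< suc K) x≡m x<1+K))

  ∈-bValuesAt⁻ : ∀ kv {B} → (∀ {z} → z ∈ kv → z ℕ.< p) → B ∈ vectors N (bValuesAt kv) → ∀ j →
                 ((toℕ j ≡ 0 ⊎ toℕ j ≡ m) → lookup B j ≡ 0) × (toℕ j ≡ K → lookup B j ∈ kv) × lookup B j ℕ.< p
  ∈-bValuesAt⁻ kv {B} kv<p B∈ j with ∈-bValues⁻ kv (toℕ j ℕ.≟ 0) (toℕ j ℕ.≟ K) (toℕ j ℕ.≟ m) K-not-m kv<p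
                                        (∈-vectors⁻ N (bValuesAt kv) B B∈ j)
  ... | vanish , atK , <p = vanish , (λ j≡K → atK j≡K λ j≡0 → 0-not-K j≡0 j≡K) , <p

  zeroBK-B zeroBK-C unitBK-B : List (Vec ℕ N)
  zeroBK-B = vectors N (bValuesAt [0])
  zeroBK-C = vectors N cValuesAt
  unitBK-B = vectors N (bValuesAt units)

  zeroBK unitBK parameters : List (Vec ℕ N × Vec ℕ N)
  zeroBK = cartesianProduct zeroBK-B zeroBK-C
  unitBK = cartesianProduct unitBK-B unitRows
  parameters = zeroBK ++ unitBK

  ∈-cValuesAt⁻ : ∀ {C} → C ∈ vectors N cValuesAt → ∀ j → CanonicalC C × lookup C j ℕ.< p
  ∈-cValuesAt⁻ {C} C∈ j = canonical , proj₂ (member j)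
    where
    member = λ j → ∈-cValues⁻ (toℕ j ℕ.<? suc K) (toℕ j ℕ.≟ m) (∈-vectors⁻ N cValuesAt C C∈ j)
    canonical : CanonicalC C
    canonical j (inj₁ j≤K) = proj₁ (member j) (inj₁ (ℕ.s≤s j≤K))
    canonical j (inj₂ j≡m) = proj₁ (member j) (inj₂ j≡m)

  unitRow-canonical : ∀ {C} → C ∈ unitRows → CanonicalC C
  unitRow-canonical (here refl) j _ = lookup-zeros j
  unitRow-canonical (there C∈) with ∈P.∈-map⁻ oneHot C∈
  ... | a , a∈ , refl = λ
    { j (inj₁ j≤K) → oneHot-≢ a j λ j≡a → ℕP.<⇒≱ (proj₁ (∈-positions⁻ a∈)) (subst (ℕ._≤ K) j≡a j≤K)
    ; j (inj₂ j≡m) → oneHot-≢ a j λ j≡a → ℕP.<⇒≱ (ℕP.<-≤-trans (proj₂ (∈-positions⁻ a∈)) (ℕP.m∸n≤m m 1))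
                                                  (ℕP.≤-reflexive (trans (sym j≡m) j≡a)) }

  unitRow<p : ∀ {C} → C ∈ unitRows → ∀ j → lookup C j ℕ.< p
  unitRow<p (here refl) j = subst (ℕ._< p) (sym (lookup-zeros j)) 0<p
  unitRow<p (there C∈) j with ∈P.∈-map⁻ oneHot C∈
  ... | a , _ , refl = ℕP.≤-<-trans (subst (ℕ._≤ 1) (sym (lookup-oneHot a j)) (𝟙≤1 (toℕ j ℕ.≟ a))) (ℕ.s≤s (ℕ.s≤s ℕ.z≤n))
    where
    𝟙≤1 : ∀ {Q : Set} (d : Dec Q) → 𝟙 d ℕ.≤ 1
    𝟙≤1 (yes _) = ℕ.s≤s ℕ.z≤n
    𝟙≤1 (no _) = ℕ.z≤n

  unitRow-condition : ∀ {C} (C∈ : C ∈ unitRows) B (canB : CanonicalB B) →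
                      Entries.ProductCondition B C canB (unitRow-canonical C∈)
  unitRow-condition C∈@(here refl) B canB =
    condition-if-y≡0 B _ canB (unitRow-canonical C∈) (λ i _ → inj₁ (lookup-zeros i)) (λ i _ _ → inj₁ (lookup-zeros i))
  unitRow-condition (there C∈) B canB with ∈P.∈-map⁻ oneHot C∈
  ... | a , a∈ , refl = condition-if-y≡0 B _ canB (unitRow-canonical (there C∈)) unit single
    where
    unit : ∀ i → Ordinary i → lookup (oneHot a) i ≡ 0 ⊎ (lookup (oneHot a) i ≡ 1 × toℕ i ≢ m ℕ.∸ 1)
    unit i _ with toℕ i ℕ.≟ a
    ... | yes i≡a = inj₂ (oneHot-≡ a i i≡a , λ i≡m∸1 → ℕP.<⇒≢ (proj₂ (∈-positions⁻ a∈)) (trans (sym i≡a) i≡m∸1))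
    ... | no i≢a = inj₁ (oneHot-≢ a i i≢a)
    single : ∀ i j → toℕ i ≢ toℕ j → lookup (oneHot a) i ≡ 0 ⊎ lookup (oneHot a) j ≡ 0
    single i j i≢j with toℕ i ℕ.≟ a
    ... | yes i≡a = inj₂ (oneHot-≢ a j λ j≡a → i≢j (trans i≡a (sym j≡a)))
    ... | no i≢a = inj₁ (oneHot-≢ a i i≢a)

  ∈parameters⇒admissible : ∀ {B C} → (B , C) ∈ parameters → Admissible B C
  ∈parameters⇒admissible {B} {C} BC∈ with ∈P.∈-++⁻ zeroBK BC∈
  ... | inj₁ BC∈zeroBK = record
    { canonicalB = canonicalB
    ; canonicalC = canonicalC
    ; B<p = λ j → proj₂ (proj₂ (B-facts j))
    ; C<p = λ j → proj₂ (C-facts j)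
    ; condition = λ i j _ _ →
        + 0 , trans (cong (λ t → + t * Entries.y B C canonicalB canonicalC i j) bK≡0) (sym (ℤP.*-zeroʳ (+ p)))
    }
    where
    B∈ = proj₁ (∈P.∈-cartesianProduct⁻ zeroBK-B zeroBK-C BC∈zeroBK)
    B-facts = ∈-bValuesAt⁻ [0] (λ z∈ → subst (ℕ._< p) (sym (∈[0]⁻ z∈)) 0<p) B∈
    C-facts = ∈-cValuesAt⁻ (proj₂ (∈P.∈-cartesianProduct⁻ zeroBK-B zeroBK-C BC∈zeroBK))
    canonicalB : CanonicalB B
    canonicalB j = proj₁ (B-facts j)
    canonicalC : CanonicalC C
    canonicalC = proj₁ (C-facts F.zero)
    bK≡0 : lookup B iK ≡ 0
    bK≡0 = ∈[0]⁻ (proj₁ (proj₂ (B-facts iK)) toℕ-iK)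
  ... | inj₂ BC∈unitBK = record
    { canonicalB = canonicalB
    ; canonicalC = unitRow-canonical C∈
    ; B<p = λ j → proj₂ (proj₂ (B-facts j))
    ; C<p = unitRow<p C∈
    ; condition = unitRow-condition C∈ B canonicalB
    }
    where
    B∈ = proj₁ (∈P.∈-cartesianProduct⁻ unitBK-B unitRows BC∈unitBK)
    C∈ = proj₂ (∈P.∈-cartesianProduct⁻ unitBK-B unitRows BC∈unitBK)
    B-facts = ∈-bValuesAt⁻ units (λ z∈ → proj₂ (∈-units⁻ z∈)) B∈
    canonicalB : CanonicalB B
    canonicalB j = proj₁ (B-facts j)

  admissible⇒∈parameters : ∀ {B C} → Admissible B C → (B , C) ∈ parameters
  admissible⇒∈parameters {B} {C} adm with lookup B iK ℕ.≟ 0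
  ... | yes bK≡0 = ∈P.∈-++⁺ˡ (∈P.∈-cartesianProduct⁺ B∈ C∈)
    where
    open Admissible adm
    B∈ : B ∈ vectors N (bValuesAt [0])
    B∈ = ∈-vectors⁺ N _ B λ j → ∈-bValues⁺ [0] (toℕ j ℕ.≟ 0) (toℕ j ℕ.≟ K) (toℕ j ℕ.≟ m)
      (canonicalB j) (λ j≡K _ → here (trans (cong (lookup B) (FinP.toℕ-injective (trans j≡K (sym toℕ-iK)))) bK≡0)) (B<p j)
    C∈ : C ∈ vectors N cValuesAt
    C∈ = ∈-vectors⁺ N _ C λ j → ∈-cValues⁺ (toℕ j ℕ.<? suc K) (toℕ j ℕ.≟ m)
      (λ { (inj₁ j<1+K) → canonicalC j (inj₁ (ℕP.≤-pred j<1+K)) ; (inj₂ j≡m) → canonicalC j (inj₂ j≡m) }) (C<p j)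
  ... | no bK≢0 = ∈P.∈-++⁺ʳ zeroBK (∈P.∈-cartesianProduct⁺ B∈ (UnitRow.C∈unitRows adm bK≢0))
    where
    open Admissible adm
    B∈ : B ∈ vectors N (bValuesAt units)
    B∈ = ∈-vectors⁺ N _ B λ j → ∈-bValues⁺ units (toℕ j ℕ.≟ 0) (toℕ j ℕ.≟ K) (toℕ j ℕ.≟ m)
      (canonicalB j)
      (λ j≡K _ → ∈-units⁺ (ℕP.n≢0⇒n>0 λ bⱼ≡0 →
                            bK≢0 (trans (cong (lookup B) (FinP.toℕ-injective (trans toℕ-iK (sym j≡K)))) bⱼ≡0))
                          (B<p j))
      (B<p j)

  unitRows⁺ : Unique unitRows
  unitRows⁺ = AllP.map⁺ (All.tabulate λ a∈ zeros≡oneHot → ℕP.1+n≢0 (sym (trans (sym (lookup-zeros (at a∈))) (trans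
                (cong (λ v → lookup v (at a∈)) zeros≡oneHot) (oneHot-≡ _ (at a∈) (toℕ-at a∈))))))
              AllPairs.∷ unique-map⁺ oneHot positions⁺ oneHot-injective
    where
    positions⁺ : Unique positions
    positions⁺ = UniqueP.applyUpTo⁺₁ (suc K ℕ.+_) R λ i<j _ → ℕP.<⇒≢ i<j ∘ ℕP.+-cancelˡ-≡ (suc K) _ _
    at : ∀ {a} → a ∈ positions → Fin N
    at a∈ = F.fromℕ< (ℕP.<-trans (ℕP.<-≤-trans (proj₂ (∈-positions⁻ a∈)) (ℕP.m∸n≤m m 1)) m<N)
    toℕ-at : ∀ {a} (a∈ : a ∈ positions) → toℕ (at a∈) ≡ a
    toℕ-at a∈ = FinP.toℕ-fromℕ< _
    oneHot-injective : ∀ {a b} → a ∈ positions → b ∈ positions → oneHot a ≡ oneHot b → a ≡ b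
    oneHot-injective {a} {b} a∈ _ oneHot≡ with a ℕ.≟ b
    ... | yes a≡b = a≡b
    ... | no a≢b = ⊥-elim (ℕP.1+n≢0 (trans (sym (oneHot-≡ a (at a∈) (toℕ-at a∈)))
                     (trans (cong (λ v → lookup v (at a∈)) oneHot≡) (oneHot-≢ b (at a∈) λ at≡b → a≢b (trans (sym (toℕ-at a∈)) at≡b)))))

  parameters⁺ : Unique parameters
  parameters⁺ = UniqueP.++⁺
    (UniqueP.cartesianProduct⁺
      (vectors⁺ N (bValuesAt [0]) λ j → bValues⁺ [0] [0]⁺ (toℕ j ℕ.≟ 0) (toℕ j ℕ.≟ K) (toℕ j ℕ.≟ m))
      (vectors⁺ N cValuesAt λ j → cValues⁺ (toℕ j ℕ.<? suc K) (toℕ j ℕ.≟ m)))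
    (UniqueP.cartesianProduct⁺
      (vectors⁺ N (bValuesAt units) λ j → bValues⁺ units units⁺ (toℕ j ℕ.≟ 0) (toℕ j ℕ.≟ K) (toℕ j ℕ.≟ m))
      unitRows⁺)
    disjoint
    where
    disjoint : ∀ {BC} → ¬ (BC ∈ zeroBK × BC ∈ unitBK)
    disjoint {B , C} (∈zeroBK , ∈unitBK) = ℕP.<⇒≢ 0<bK (sym bK≡0)
      where
      bK≡0 = ∈[0]⁻ (proj₁ (proj₂ (∈-bValuesAt⁻ [0] (λ z∈ → subst (ℕ._< p) (sym (∈[0]⁻ z∈)) 0<p)
                                    (proj₁ (∈P.∈-cartesianProduct⁻ zeroBK-B zeroBK-C ∈zeroBK)) iK)) toℕ-iK)
      0<bK = proj₁ (∈-units⁻ (proj₁ (proj₂ (∈-bValuesAt⁻ units (λ z∈ → proj₂ (∈-units⁻ z∈))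
                                 (proj₁ (∈P.∈-cartesianProduct⁻ unitBK-B unitRows ∈unitBK)) iK)) toℕ-iK))

  bFreeAt cFreeAt : Fin N → ℕ
  bFreeAt j = bFree (toℕ j ℕ.≟ 0) (toℕ j ℕ.≟ K) (toℕ j ℕ.≟ m)
  cFreeAt j = cFree (toℕ j ℕ.<? suc K) (toℕ j ℕ.≟ m)

  sum-bFreeAt : sum bFreeAt ≡ m ℕ.∸ 2
  sum-bFreeAt = trans (sym (ℕP.m+n∸n≡m (sum bFreeAt) 3)) (cong (ℕ._∸ 3) (trans (cong (sum bFreeAt ℕ.+_) (sym three)) total))
    where
    𝟙₀ 𝟙_K 𝟙ₘ : Fin N → ℕ
    𝟙₀ j = 𝟙 (toℕ j ℕ.≟ 0)
    𝟙_K j = 𝟙 (toℕ j ℕ.≟ K)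
    𝟙ₘ j = 𝟙 (toℕ j ℕ.≟ m)
    total = sum-complement bFreeAt (λ j → 𝟙₀ j ℕ.+ 𝟙_K j ℕ.+ 𝟙ₘ j)
              λ j → bFree-partition (toℕ j ℕ.≟ 0) (toℕ j ℕ.≟ K) (toℕ j ℕ.≟ m) 0-not-K 0-not-m K-not-m
    three : sum (λ j → 𝟙₀ j ℕ.+ 𝟙_K j ℕ.+ 𝟙ₘ j) ≡ 3
    three = trans (∑-distrib-+ (λ j → 𝟙₀ j ℕ.+ 𝟙_K j) 𝟙ₘ) (cong₂ ℕ._+_ (trans (∑-distrib-+ 𝟙₀ 𝟙_K)
              (cong₂ ℕ._+_ (sum-𝟙-≡ N 0 (ℕ.s≤s ℕ.z≤n)) (sum-𝟙-≡ N K (K<N))))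
              (sum-𝟙-≡ N m m<N))

  sum-cFreeAt : sum cFreeAt ≡ m ℕ.∸ suc K
  sum-cFreeAt = trans (sym (ℕP.m+n∸n≡m (sum cFreeAt) (suc (suc K))))
                      (cong (ℕ._∸ suc (suc K)) (trans (cong (sum cFreeAt ℕ.+_) (sym K+2)) total))
    where
    𝟙≤ 𝟙ₘ : Fin N → ℕ
    𝟙≤ j = 𝟙 (toℕ j ℕ.<? suc K)
    𝟙ₘ j = 𝟙 (toℕ j ℕ.≟ m)
    total = sum-complement cFreeAt (λ j → 𝟙≤ j ℕ.+ 𝟙ₘ j)
              λ j → cFree-partition (toℕ j ℕ.<? suc K) (toℕ j ℕ.≟ m) ≤K-not-m
    K+2 : sum (λ j → 𝟙≤ j ℕ.+ 𝟙ₘ j) ≡ suc (suc K)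
    K+2 = trans (∑-distrib-+ 𝟙≤ 𝟙ₘ) (trans (cong₂ ℕ._+_ (sum-𝟙-< N (suc K) (K<N)) (sum-𝟙-≡ N m m<N))
                                          (ℕP.+-comm (suc K) 1))

  length-bVectors : ∀ kv → length (vectors N (bValuesAt kv)) ≡ p ℕ.^ (m ℕ.∸ 2) ℕ.* length kv
  length-bVectors kv = begin
      length (vectors N (bValuesAt kv))
    ≡⟨ length-vectors N (bValuesAt kv) ⟩
      product (λ (j : Fin N) → length (bValuesAt kv j))
    ≡⟨ product-cong-≗ {N} (λ (j : Fin N) → length-bValues kv (toℕ j ℕ.≟ 0) (toℕ j ℕ.≟ K) (toℕ j ℕ.≟ m) 0-not-K) ⟩
      product (λ (j : Fin N) → p ℕ.^ bFreeAt j ℕ.* length kv ℕ.^ 𝟙 (toℕ j ℕ.≟ K))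
    ≡⟨ product-distrib-* (λ (j : Fin N) → p ℕ.^ bFreeAt j) (λ (j : Fin N) → length kv ℕ.^ 𝟙 (toℕ j ℕ.≟ K)) ⟩
      product (λ (j : Fin N) → p ℕ.^ bFreeAt j) ℕ.* product (λ (j : Fin N) → length kv ℕ.^ 𝟙 (toℕ j ℕ.≟ K))
    ≡⟨ cong₂ ℕ._*_ (trans (product-^ p bFreeAt) (cong (p ℕ.^_) sum-bFreeAt))
                   (trans (product-^ (length kv) (λ (j : Fin N) → 𝟙 (toℕ j ℕ.≟ K))) (trans (cong (length kv ℕ.^_) (sum-𝟙-≡ N K (K<N)))
                                                           (ℕP.*-identityʳ (length kv)))) ⟩
      p ℕ.^ (m ℕ.∸ 2) ℕ.* length kv ∎
    where open ≡-Reasoning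

  length-zeroBK-C : length zeroBK-C ≡ p ℕ.^ (m ℕ.∸ suc K)
  length-zeroBK-C = trans (length-vectors N cValuesAt)
    (trans (product-cong-≗ {N} (λ j → length-cValues (toℕ j ℕ.<? suc K) (toℕ j ℕ.≟ m)))
           (trans (product-^ p cFreeAt) (cong (p ℕ.^_) sum-cFreeAt)))

  length-unitRows : length unitRows ≡ m ℕ.∸ suc K
  length-unitRows = trans (cong suc (trans (ListP.length-map oneHot positions) (ListP.length-applyUpTo _ R)))
                          (sym (ℕP.+-∸-assoc 1 2+K≤m))

  length-parameters : length parameters ≡
    p ℕ.^ (m ℕ.∸ 2 ℕ.+ (m ℕ.∸ suc K)) ℕ.+ p ℕ.^ (m ℕ.∸ 2) ℕ.* (p ℕ.∸ 1) ℕ.* (m ℕ.∸ suc K)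
  length-parameters = trans (ListP.length-++ zeroBK) (cong₂ ℕ._+_
    (trans (length-cartesianProductWith _,_ zeroBK-B zeroBK-C)
           (trans (cong₂ ℕ._*_ (trans (length-bVectors [0]) (ℕP.*-identityʳ (p ℕ.^ (m ℕ.∸ 2)))) length-zeroBK-C)
                  (sym (ℕP.^-distribˡ-+-* p (m ℕ.∸ 2) (m ℕ.∸ suc K)))))
    (trans (length-cartesianProductWith _,_ unitBK-B unitRows)
           (cong₂ ℕ._*_ (trans (length-bVectors units) (cong (p ℕ.^ (m ℕ.∸ 2) ℕ.*_) length-units)) length-unitRows)))

  count : gCount p m (alpha m (suc K) β)
            (p ℕ.^ (m ℕ.∸ 2 ℕ.+ (m ℕ.∸ suc K)) ℕ.+ p ℕ.^ (m ℕ.∸ 2) ℕ.* (p ℕ.∸ 1) ℕ.* (m ℕ.∸ suc K))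
  count = List.map matrixOf parameters , matrices⁺ , (λ A → mk⇔ (∈⇒irr A) (irr⇒∈ A)) ,
          trans (ListP.length-map matrixOf parameters) length-parameters
    where
    matrixOf : Vec ℕ N × Vec ℕ N → Matrix N
    matrixOf (B , C) = matrix B C
    matrices⁺ : Unique (List.map matrixOf parameters)
    matrices⁺ = unique-map⁺ matrixOf parameters⁺ λ BC∈ BC′∈ →
      matrix-injective (∈parameters⇒admissible BC∈) (∈parameters⇒admissible BC′∈)
    ∈⇒irr : ∀ A → A ∈ List.map matrixOf parameters → IsIrr A
    ∈⇒irr A A∈ with ∈P.∈-map⁻ matrixOf A∈
    ... | (B , C) , BC∈ , refl = admissible⇒irreducible (∈parameters⇒admissible BC∈)
    irr⇒∈ : ∀ A → IsIrr A → A ∈ List.map matrixOf parameters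
    irr⇒∈ A irr = subst (_∈ List.map matrixOf parameters) (sym A≡matrix)
                        (∈P.∈-map⁺ matrixOf (admissible⇒∈parameters admissible))
      where open FromMatrix A irr

open import Data.Nat using (_+_; _*_; _∸_; _^_; _≤_; _<_; s≤s)

lemma3p2 : ∀ (p m k β : ℕ) → Prime p → 4 ≤ suc m → 2 ≤ k → k ≤ suc m ∸ 2 → 1 < β →
             gCount p m (alpha m k β)
               (p ^ (suc m ∸ 3 + (suc m ∸ 1 ∸ k)) + p ^ (suc m ∸ 3) * (p ∸ 1) * (suc m ∸ 1 ∸ k))
lemma3p2 (suc (suc p′)) (suc m′) (suc (suc K′)) β p-prime _ _ k≤n-2 1<β =
  Count.count p′ (suc m′) (suc K′) β p-prime (λ ()) (s≤s k≤n-2) 1<β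
lemma3p2 _ _ (suc 0) _ _ _ (s≤s ()) _ _
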